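{- Let $k,\ell\ge1$, let $\mu\in\mathbb Z^\ell$ with all entries $\le k$ and $\mu_i+\ell-i\ge\mu_{i+1}+\ell-i-1$ for $1\le i<\ell$, let $\Psi=\Delta^k(\mu)$ and $z\in[\ell-1]$. Suppose that $y+1=\mathrm{up}_\Psi(z+1)$ is defined, that $\mu_z=\mu_{z+1}-1$, and that $\mu_{z+1}\ge\mu_{z+2}$ and $\mu_y\ge\mu_{y+1}$ (with the conventions $\mu_0=k$ and $\mu_{\ell+1}=0$). Then $$\mathfrak s^{(k)}_\mu=t\,\mathfrak s^{(k)}_{\mu+\epsilon_{y+1}-\epsilon_{z+1}}.$$
   Context: $[n]=\{1,\dots,n\}$; $\epsilon_i\in\mathbb Z^\ell$ standard basis vectors. For $\gamma\in\mathbb Z^\ell$, $s_\gamma=\det(h_{\gamma_i+j-i})_{1\le i,j\le\ell}$ ($h_0=1$, $h_d=0$ for $d<0$). $\Delta^+_\ell=\{(i,j):1\le i<j\le\ell\}$ with partial order $(a,b)\le(c,d)$ iff $a\ge c$ and $b\le d$; a root ideal is an upper order ideal. For $\Psi\subset\Delta^+_\ell$ and $\gamma\in\mathbb Z^\ell$, $H(\Psi;\gamma)$ is obtained by expanding $\prod_{(i,j)\in\Psi}(1-tz_i/z_j)^{ -1}z^\gamma$ as a power series in $t$ and applying coefficientwise the linear map $z^\beta\mapsto s_\beta$. For $\nu\in\mathbb Z^\ell$ with entries $\le k$, $\Delta^k(\nu)=\{(i,j)\in\Delta^+_\ell:k-\nu_i+i<j\}$ and $\mathfrak s^{(k)}_\nu=H(\Delta^k(\nu);\nu)$.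 A root $\alpha\in\Psi$ is removable if $\Psi\setminus\{\alpha\}$ is a root ideal; $\mathrm{up}_\Psi(x)=i$ if $(i,x)$ is a removable root of $\Psi$, undefined otherwise. -}

module Defs where

open import Level using (Level)
open import Data.Nat as ℕ using (ℕ; zero; suc; _∸_)
open import Data.Integer as ℤ using (ℤ; +_; -[1+_]; +[1+_])
open import Data.Fin as Fin using (Fin; toℕ; punchIn)
open import Data.List using (List; []; _∷_; concatMap; map; filter)
open import Data.Product using (_×_; _,_; proj₁; proj₂)
open import Data.Bool using (if_then_else_)
open import Relation.Nullary using (yes; no; ¬_)
open import Relation.Nullary.Decidable using (_×-dec_)
open import Relation.Unary using (Decidable)
open import Relation.Binary.PropositionalEquality using (_≡_; _≢_)
open import Algebra.Bundles using (CommutativeRing)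

-- Compositions γ ∈ ℤ^ℓ are functions Fin ℓ → ℤ; paper index i (1-based)
-- corresponds to Fin index i-1.

-- 1-based lookup γ_i (value 0 outside 1..ℓ)
_⟨_⟩ : ∀ {ℓ} → (Fin ℓ → ℤ) → ℕ → ℤ
_⟨_⟩ {ℓ} γ zero = + 0
_⟨_⟩ {ℓ} γ (suc i) with i ℕ.<? ℓ
... | yes p = γ (Fin.fromℕ< p)
... | no _ = + 0

-- μ with the conventions μ_0 = k and μ_{ℓ+1} = 0
μext : ∀ {ℓ} → ℕ → (Fin ℓ → ℤ) → ℕ → ℤ
μext k μ zero = + k
μext k μ (suc i) = μ ⟨ suc i ⟩

addε : ∀ {ℓ} → (Fin ℓ → ℤ) → ℕ → ℤ → (Fin ℓ → ℤ)
addε γ i c f = if suc (toℕ f) ℕ.≡ᵇ i then γ f ℤ.+ c else γ f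

Root : Set
Root = ℕ × ℕ

Pos : ℕ → Root → Set
Pos ℓ (i , j) = (1 ℕ.≤ i) × ((i ℕ.< j) × (j ℕ.≤ ℓ))

_≤ᴿ_ : Root → Root → Set
(a , b) ≤ᴿ (c , d) = (c ℕ.≤ a) × (b ℕ.≤ d)

IsRootIdeal : ℕ → (Root → Set) → Set
IsRootIdeal ℓ Ψ = (∀ α → Ψ α → Pos ℓ α)
                × (∀ α β → Ψ α → Pos ℓ β → α ≤ᴿ β → Ψ β)

Removable : ℕ → (Root → Set) → Root → Set
Removable ℓ Ψ α = Ψ α × IsRootIdeal ℓ (λ β → Ψ β × (β ≢ α))

-- up_Ψ(x) is defined and equals i
UpIs : ℕ → (Root → Set) → ℕ → ℕ → Set
UpIs ℓ Ψ x i = Removable ℓ Ψ (i , x)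

Δk : ∀ {ℓ} → ℕ → (Fin ℓ → ℤ) → Root → Set
Δk {ℓ} k ν (i , j) = Pos ℓ (i , j) × (((+ k ℤ.- ν ⟨ i ⟩) ℤ.+ + i) ℤ.< + j)

Δk? : ∀ {ℓ} (k : ℕ) (ν : Fin ℓ → ℤ) → Decidable (Δk k ν)
Δk? {ℓ} k ν (i , j) =
  ((1 ℕ.≤? i) ×-dec ((i ℕ.<? j) ×-dec (j ℕ.≤? ℓ)))
  ×-dec (((+ k ℤ.- ν ⟨ i ⟩) ℤ.+ + i) ℤ.<? + j)

oneTo : ℕ → List ℕ
oneTo zero = []
oneTo (suc n) = oneTo n Data.List.++ (suc n ∷ [])

allPairs : ℕ → List Root
allPairs ℓ = concatMap (λ i → map (λ j → (i , j)) (oneTo ℓ)) (oneTo ℓ)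

Δk-list : ∀ {ℓ} → ℕ → (Fin ℓ → ℤ) → List Root
Δk-list {ℓ} k ν = filter (Δk? k ν) (allPairs ℓ)

-- Symmetric functions.  Λ = ℤ[h₁,h₂,…] is the free commutative ring on
-- the h_d (d ≥ 1); an identity holds in Λ iff it holds for every
-- commutative ring R and every choice of values h : ℕ → R (h d = h_d, d ≥ 1).

module Sym {a b : Level} (R : CommutativeRing a b) (h : ℕ → CommutativeRing.Carrier R) where
  open CommutativeRing R

  hZ : ℤ → Carrier
  hZ (+ zero) = 1#
  hZ +[1+ n ] = h (suc n)
  hZ -[1+ _ ] = 0#

  sumFin : ∀ n → (Fin n → Carrier) → Carrier
  sumFin zero f = 0#
  sumFin (suc n) f = f Fin.zero + sumFin n (λ i → f (Fin.suc i))

  sumTo : ℕ → (ℕ → Carrier) → Carrier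
  sumTo zero f = f 0
  sumTo (suc n) f = sumTo n f + f (suc n)

  alt : ℕ → Carrier → Carrier
  alt zero x = x
  alt (suc n) x = - alt n x

  det : ∀ n → (Fin n → Fin n → Carrier) → Carrier
  det zero M = 1#
  det (suc n) M =
    sumFin (suc n) (λ j → alt (toℕ j) (M Fin.zero j * det n (λ r c → M (Fin.suc r) (punchIn j c))))

  s : ∀ {ℓ} → (Fin ℓ → ℤ) → Carrier
  s {ℓ} γ = det ℓ (λ i j → hZ ((γ i ℤ.+ + toℕ j) ℤ.- + toℕ i))

  -- formal power series in t with coefficients in R
  Series : Set a
  Series = ℕ → Carrier

  _≈ˢ_ : Series → Series → Set b
  F ≈ˢ G = ∀ n → F n ≈ G n

  t·_ : Series → Series
  (t· F) zero = 0#
  (t· F) (suc n) = F n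

  -- coefficient of t^n in  ∏_{(i,j)∈Ψ} (1 - t z_i/z_j)^{-1} z^γ  after z^β ↦ s_β
  Hcoef : ∀ {ℓ} → List Root → (Fin ℓ → ℤ) → Series
  Hcoef [] γ zero = s γ
  Hcoef [] γ (suc n) = 0#
  Hcoef ((i , j) ∷ Ψ) γ n =
    sumTo n (λ m → Hcoef Ψ (addε (addε γ i (+ m)) j (ℤ.- (+ m))) (n ∸ m))

  H : ∀ {ℓ} → List Root → (Fin ℓ → ℤ) → Series
  H Ψ γ = Hcoef Ψ γ

  kS : ∀ {ℓ} → ℕ → (Fin ℓ → ℤ) → Series
  kS k ν = H (Δk-list k ν) ν

-- Let σ be the transposition of z and z+1, acting on compositions by the dot action
-- σ·γ = σ(γ - ρ) + ρ and on roots by permuting indices.  Swapping two rows of the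
-- Jacobi–Trudi determinant gives s_{σ·γ} = -s_γ, hence s_γ = 0 when σ·γ = γ.  Since
-- raising operators commute and σ·(R_x γ) = R_{σx}(σ·γ), the same holds for H(L; γ) whenever
-- the root set L is σ-stable: pairing every root x ≠ σx with σx turns the double sum over
-- their exponents into an antisymmetric one.  The hypothesis μ_z = μ_{z+1} - 1 says σ·μ = μ.
-- Splitting off the removable root α = (y+1, z+1) of Ψ = Δ^k(μ) gives
-- 𝔰_μ = H(Ψ∖α; μ) + t·H(Ψ; ν) with ν = μ + ε_{y+1} - ε_{z+1}, and Ψ∖α is σ-stable, so the
-- first term vanishes.  Finally Δ^k(ν) is obtained from Ψ by adding at most (y+1, z) and
-- removing at most one root (z+1, ·); the same cancellation in the σ-stable set Ψ ∪ Δ^k(ν)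
-- gives H(Ψ; ν) = H(Δ^k(ν); ν) = 𝔰_ν.

module Submission where

open import Defs
open import Level using (Level; 0ℓ)
open import Data.Bool using (Bool; true; false; if_then_else_; T)
open import Data.Empty using (⊥-elim)
open import Data.Nat as ℕ using (ℕ; zero; suc; _∸_; s≤s; z≤n)
import Data.Nat.Properties as ℕP
open import Data.Integer as ℤ using (ℤ; +_; +≤+; +<+)
import Data.Integer.Properties as ℤP
open import Data.Integer.Tactic.RingSolver using (solve-∀)
open import Data.Fin as Fin using (Fin; toℕ; punchIn; zero; suc)
import Data.Fin.Properties as FinP
open import Data.Product using (_×_; _,_; proj₁; proj₂; ∃₂)
import Data.Product.Properties as ×P
open import Data.Sum using (_⊎_; inj₁; inj₂)
open import Data.List using (List; []; _∷_; _++_; length; filter; map; concatMap; cartesianProduct)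
import Data.List.Properties as ListP
open import Data.List.Relation.Binary.Permutation.Propositional as Perm using (_↭_; ↭⇒↭ₛ)
import Data.List.Relation.Binary.Permutation.Propositional.Properties as PermP
open import Data.List.Relation.Unary.All as All using (All; []; _∷_)
open import Data.List.Relation.Unary.Any using (here; there)
open import Data.List.Relation.Unary.Unique.Propositional using (Unique; []; _∷_) renaming (tail to Unique-tail)
import Data.List.Relation.Unary.Unique.Propositional.Properties as UniqueP
open import Data.List.Membership.Propositional using (_∈_)
open import Data.List.Membership.Propositional.Properties
  using (∈-∃++; ∈-++⁺ˡ; ∈-++⁺ʳ; ∈-++⁻; ∈-cartesianProduct⁺; ∈-filter⁺; ∈-filter⁻)
open import Relation.Nullary using (Dec; yes; no; ¬_; ¬?)
open import Relation.Nullary.Decidable using (_×-dec_; _⊎-dec_)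
open import Relation.Unary using (Pred; Decidable)
open import Relation.Binary.PropositionalEquality as ≡ using (_≡_; _≢_; _≗_)
open import Relation.Binary.Definitions using (tri<; tri≈; tri>)
open import Algebra.Bundles using (CommutativeRing)
open import Function using (_∘_)

swapAdj : ℕ → ℕ → ℕ
swapAdj zero zero = 1
swapAdj zero (suc zero) = 0
swapAdj zero (suc (suc x)) = suc (suc x)
swapAdj (suc p) zero = zero
swapAdj (suc p) (suc x) = suc (swapAdj p x)

swapAdj-involutive : ∀ p x → swapAdj p (swapAdj p x) ≡ x
swapAdj-involutive zero zero = ≡.refl
swapAdj-involutive zero (suc zero) = ≡.refl
swapAdj-involutive zero (suc (suc x)) = ≡.refl
swapAdj-involutive (suc p) zero = ≡.refl
swapAdj-involutive (suc p) (suc x) = ≡.cong suc (swapAdj-involutive p x)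

swapAdj-self : ∀ p → swapAdj p p ≡ suc p
swapAdj-self zero = ≡.refl
swapAdj-self (suc p) = ≡.cong suc (swapAdj-self p)

swapAdj-suc : ∀ p → swapAdj p (suc p) ≡ p
swapAdj-suc zero = ≡.refl
swapAdj-suc (suc p) = ≡.cong suc (swapAdj-suc p)

swapAdj-other : ∀ p x → x ≢ p → x ≢ suc p → swapAdj p x ≡ x
swapAdj-other zero zero x≢p _ = ⊥-elim (x≢p ≡.refl)
swapAdj-other zero (suc zero) _ x≢1+p = ⊥-elim (x≢1+p ≡.refl)
swapAdj-other zero (suc (suc x)) _ _ = ≡.refl
swapAdj-other (suc p) zero _ _ = ≡.refl
swapAdj-other (suc p) (suc x) x≢p x≢1+p =
  ≡.cong suc (swapAdj-other p x (x≢p ∘ ≡.cong suc) (x≢1+p ∘ ≡.cong suc))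

T-extensional : ∀ {b c : Bool} → (T b → T c) → (T c → T b) → b ≡ c
T-extensional {false} {false} _ _ = ≡.refl
T-extensional {false} {true} _ c⇒b = ⊥-elim (c⇒b _)
T-extensional {true} {false} b⇒c _ = ⊥-elim (b⇒c _)
T-extensional {true} {true} _ _ = ≡.refl

swapAdj-≡ᵇ : ∀ p x c → (swapAdj p x ℕ.≡ᵇ c) ≡ (x ℕ.≡ᵇ swapAdj p c)
swapAdj-≡ᵇ p x c = T-extensional
  (λ t → ℕP.≡⇒≡ᵇ x (swapAdj p c)
     (≡.trans (≡.sym (swapAdj-involutive p x)) (≡.cong (swapAdj p) (ℕP.≡ᵇ⇒≡ _ c t))))
  (λ t → ℕP.≡⇒≡ᵇ (swapAdj p x) c
     (≡.trans (≡.cong (swapAdj p) (ℕP.≡ᵇ⇒≡ x _ t)) (swapAdj-involutive p c)))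

-- swapFin r exchanges r and suc r (it is the identity if suc r is out of range).
swapFin : ∀ {n} → ℕ → Fin n → Fin n
swapFin (suc r) zero = zero
swapFin (suc r) (suc i) = suc (swapFin r i)
swapFin {suc (suc n)} zero zero = suc zero
swapFin {suc (suc n)} zero (suc zero) = zero
swapFin {suc (suc n)} zero (suc (suc i)) = suc (suc i)
swapFin {suc zero} zero zero = zero

toℕ-swapFin : ∀ {n} r (i : Fin n) → suc r ℕ.< n → toℕ (swapFin r i) ≡ swapAdj r (toℕ i)
toℕ-swapFin (suc r) zero _ = ≡.refl
toℕ-swapFin (suc r) (suc i) (s≤s r<n) = ≡.cong suc (toℕ-swapFin r i r<n)
toℕ-swapFin {suc (suc n)} zero zero _ = ≡.refl
toℕ-swapFin {suc (suc n)} zero (suc zero) _ = ≡.refl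
toℕ-swapFin {suc (suc n)} zero (suc (suc i)) _ = ≡.refl
toℕ-swapFin {suc zero} zero zero (s≤s ())

-- A total variant of punchOut: the position of v once u is deleted (junk when u ≡ v).
punchOut₀ : ∀ {m} → Fin (suc (suc m)) → Fin (suc (suc m)) → Fin (suc m)
punchOut₀ zero zero = zero
punchOut₀ zero (suc v) = v
punchOut₀ (suc u) zero = zero
punchOut₀ {suc m} (suc u) (suc v) = suc (punchOut₀ u v)
punchOut₀ {zero} (suc u) (suc v) = zero

punchOut₀-punchIn : ∀ {m} (j : Fin (suc (suc m))) (c : Fin (suc m)) → punchOut₀ j (punchIn j c) ≡ c
punchOut₀-punchIn zero c = ≡.refl
punchOut₀-punchIn (suc j) zero = ≡.refl
punchOut₀-punchIn {suc m} (suc j) (suc c) = ≡.cong suc (punchOut₀-punchIn j c)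

punchIn-punchOut₀-comm : ∀ {m} (u v : Fin (suc (suc m))) → u ≢ v → (c : Fin m)
  → punchIn u (punchIn (punchOut₀ u v) c) ≡ punchIn v (punchIn (punchOut₀ v u) c)
punchIn-punchOut₀-comm zero zero u≢v c = ⊥-elim (u≢v ≡.refl)
punchIn-punchOut₀-comm zero (suc v) _ c = ≡.refl
punchIn-punchOut₀-comm (suc u) zero _ c = ≡.refl
punchIn-punchOut₀-comm {suc m} (suc u) (suc v) _ zero = ≡.refl
punchIn-punchOut₀-comm {suc m} (suc u) (suc v) u≢v (suc c) =
  ≡.cong suc (punchIn-punchOut₀-comm u v (u≢v ∘ ≡.cong suc) c)

punchIn-≢ : ∀ {n} (j : Fin (suc n)) c → j ≢ punchIn j c
punchIn-≢ j c = FinP.punchInᵢ≢i j c ∘ ≡.sym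

+-suc-suc : ∀ {a b c d} → a ℕ.+ b ≡ suc (c ℕ.+ d) → suc a ℕ.+ suc b ≡ suc (suc c ℕ.+ suc d)
+-suc-suc {a} {b} {c} {d} e =
  ≡.cong suc (≡.trans (ℕP.+-suc a b) (≡.cong suc (≡.trans e (≡.sym (ℕP.+-suc c d)))))

-- Deleting the two columns u, v in either order: the Laplace signs differ by one.
punchOut₀-parity : ∀ {m} (u v : Fin (suc (suc m))) → u ≢ v
  → (toℕ u ℕ.+ toℕ (punchOut₀ u v) ≡ suc (toℕ v ℕ.+ toℕ (punchOut₀ v u)))
    ⊎ (toℕ v ℕ.+ toℕ (punchOut₀ v u) ≡ suc (toℕ u ℕ.+ toℕ (punchOut₀ u v)))
punchOut₀-parity zero zero u≢v = ⊥-elim (u≢v ≡.refl)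
punchOut₀-parity zero (suc v) _ = inj₂ (≡.cong suc (ℕP.+-identityʳ (toℕ v)))
punchOut₀-parity (suc u) zero _ = inj₁ (≡.cong suc (ℕP.+-identityʳ (toℕ u)))
punchOut₀-parity {zero} (suc zero) (suc zero) u≢v = ⊥-elim (u≢v ≡.refl)
punchOut₀-parity {suc m} (suc u) (suc v) u≢v with punchOut₀-parity u v (u≢v ∘ ≡.cong suc)
... | inj₁ e = inj₁ (+-suc-suc e)
... | inj₂ e = inj₂ (+-suc-suc e)

if-T : ∀ {a} {A : Set a} {b : Bool} {x y : A} → T b → (if b then x else y) ≡ x
if-T {b = true} _ = ≡.refl

if-¬T : ∀ {a} {A : Set a} {b : Bool} {x y : A} → ¬ T b → (if b then x else y) ≡ y
if-¬T {b = false} _ = ≡.refl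
if-¬T {b = true} ¬t = ⊥-elim (¬t _)

module _ {ℓ : ℕ} where

  addε-≡ : ∀ (γ : Fin ℓ → ℤ) {c} d {f} → suc (toℕ f) ≡ c → addε γ c d f ≡ γ f ℤ.+ d
  addε-≡ γ d e = if-T (ℕP.≡⇒≡ᵇ _ _ e)

  addε-≢ : ∀ (γ : Fin ℓ → ℤ) {c} d {f} → suc (toℕ f) ≢ c → addε γ c d f ≡ γ f
  addε-≢ γ d ne = if-¬T (ne ∘ ℕP.≡ᵇ⇒≡ _ _)

  ⟨⟩-toℕ : ∀ (γ : Fin ℓ → ℤ) f → γ ⟨ suc (toℕ f) ⟩ ≡ γ f
  ⟨⟩-toℕ γ f with toℕ f ℕ.<? ℓ
  ... | yes f<ℓ = ≡.cong γ (FinP.fromℕ<-toℕ f f<ℓ)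
  ... | no f≮ℓ = ⊥-elim (f≮ℓ (FinP.toℕ<n f))

  ⟨⟩-addε-≡ : ∀ (γ : Fin ℓ → ℤ) {c} d → 1 ℕ.≤ c → c ℕ.≤ ℓ → addε γ c d ⟨ c ⟩ ≡ γ ⟨ c ⟩ ℤ.+ d
  ⟨⟩-addε-≡ γ {suc c} d _ c<ℓ with c ℕ.<? ℓ
  ... | yes c<ℓ′ = addε-≡ γ d (≡.cong suc (FinP.toℕ-fromℕ< c<ℓ′))
  ... | no c≮ℓ = ⊥-elim (c≮ℓ c<ℓ)

  ⟨⟩-addε-≢ : ∀ (γ : Fin ℓ → ℤ) {c} d {i} → i ≢ c → addε γ c d ⟨ i ⟩ ≡ γ ⟨ i ⟩
  ⟨⟩-addε-≢ γ d {zero} _ = ≡.refl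
  ⟨⟩-addε-≢ γ d {suc i} i≢c with i ℕ.<? ℓ
  ... | yes i<ℓ = addε-≢ γ d (i≢c ∘ ≡.trans (≡.cong suc (≡.sym (FinP.toℕ-fromℕ< i<ℓ))))
  ... | no _ = ≡.refl

  ε : ℕ → ℤ → Fin ℓ → ℤ
  ε a c f = if suc (toℕ f) ℕ.≡ᵇ a then c else + 0

  addε-apply : ∀ (γ : Fin ℓ → ℤ) a c f → addε γ a c f ≡ γ f ℤ.+ ε a c f
  addε-apply γ a c f with suc (toℕ f) ℕ.≡ᵇ a
  ... | true = ≡.refl
  ... | false = ≡.sym (ℤP.+-identityʳ (γ f))

  ε-+ : ∀ a c d f → ε a (c ℤ.+ d) f ≡ ε a c f ℤ.+ ε a d f
  ε-+ a c d f with suc (toℕ f) ℕ.≡ᵇ a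
  ... | true = ≡.refl
  ... | false = ≡.refl

  ε-neg : ∀ a c f → ε a (ℤ.- c) f ≡ ℤ.- ε a c f
  ε-neg a c f with suc (toℕ f) ℕ.≡ᵇ a
  ... | true = ≡.refl
  ... | false = ≡.refl

  ε-zero : ∀ a f → ε a (+ 0) f ≡ + 0
  ε-zero a f with suc (toℕ f) ℕ.≡ᵇ a
  ... | true = ≡.refl
  ... | false = ≡.refl

  raise : Root → ℕ → (Fin ℓ → ℤ) → Fin ℓ → ℤ
  raise (i , j) m γ = addε (addε γ i (+ m)) j (ℤ.- (+ m))

  raiseε : Root → ℕ → Fin ℓ → ℤ
  raiseε (i , j) m f = ε i (+ m) f ℤ.- ε j (+ m) f

  raise-apply : ∀ x m (γ : Fin ℓ → ℤ) f → raise x m γ f ≡ γ f ℤ.+ raiseε x m f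
  raise-apply (i , j) m γ f = begin
    addε (addε γ i (+ m)) j (ℤ.- + m) f    ≡⟨ addε-apply (addε γ i (+ m)) j (ℤ.- + m) f ⟩
    addε γ i (+ m) f ℤ.+ ε j (ℤ.- + m) f   ≡⟨ ≡.cong₂ ℤ._+_ (addε-apply γ i (+ m) f) (ε-neg j (+ m) f) ⟩
    (γ f ℤ.+ ε i (+ m) f) ℤ.- ε j (+ m) f  ≡⟨ ℤP.+-assoc (γ f) (ε i (+ m) f) (ℤ.- ε j (+ m) f) ⟩
    γ f ℤ.+ raiseε (i , j) m f             ∎
    where open ≡.≡-Reasoning

  raise-cong : ∀ {γ γ′ : Fin ℓ → ℤ} x m → γ ≗ γ′ → raise x m γ ≗ raise x m γ′
  raise-cong {γ} {γ′} x m γ≗γ′ f = begin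
    raise x m γ f             ≡⟨ raise-apply x m γ f ⟩
    γ f ℤ.+ raiseε x m f      ≡⟨ ≡.cong (ℤ._+ raiseε x m f) (γ≗γ′ f) ⟩
    γ′ f ℤ.+ raiseε x m f     ≡⟨ raise-apply x m γ′ f ⟨
    raise x m γ′ f            ∎
    where open ≡.≡-Reasoning

  raise-zero : ∀ x (γ : Fin ℓ → ℤ) → raise x 0 γ ≗ γ
  raise-zero (i , j) γ f = begin
    raise (i , j) 0 γ f                       ≡⟨ raise-apply (i , j) 0 γ f ⟩
    γ f ℤ.+ (ε i (+ 0) f ℤ.- ε j (+ 0) f)     ≡⟨ ≡.cong₂ (λ u v → γ f ℤ.+ (u ℤ.- v)) (ε-zero i f) (ε-zero j f) ⟩
    γ f ℤ.+ + 0                               ≡⟨ ℤP.+-identityʳ (γ f) ⟩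
    γ f                                       ∎
    where open ≡.≡-Reasoning

  raise-comm : ∀ x y m n (γ : Fin ℓ → ℤ) → raise x m (raise y n γ) ≗ raise y n (raise x m γ)
  raise-comm x y m n γ f = begin
    raise x m (raise y n γ) f                    ≡⟨ raise-apply x m (raise y n γ) f ⟩
    raise y n γ f ℤ.+ raiseε x m f               ≡⟨ ≡.cong (ℤ._+ raiseε x m f) (raise-apply y n γ f) ⟩
    (γ f ℤ.+ raiseε y n f) ℤ.+ raiseε x m f      ≡⟨ ℤP.+-assoc (γ f) _ _ ⟩
    γ f ℤ.+ (raiseε y n f ℤ.+ raiseε x m f)      ≡⟨ ≡.cong (ℤ._+_ (γ f)) (ℤP.+-comm (raiseε y n f) _) ⟩
    γ f ℤ.+ (raiseε x m f ℤ.+ raiseε y n f)      ≡⟨ ℤP.+-assoc (γ f) _ _ ⟨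
    (γ f ℤ.+ raiseε x m f) ℤ.+ raiseε y n f      ≡⟨ ≡.cong (ℤ._+ raiseε y n f) (raise-apply x m γ f) ⟨
    raise x m γ f ℤ.+ raiseε y n f               ≡⟨ raise-apply y n (raise x m γ) f ⟨
    raise y n (raise x m γ) f                    ∎
    where open ≡.≡-Reasoning

  raiseε-suc : ∀ x m f → raiseε x (suc m) f ≡ raiseε x 1 f ℤ.+ raiseε x m f
  raiseε-suc (i , j) m f =
    ≡.trans (≡.cong₂ ℤ._-_ (ε-+ i (+ 1) (+ m) f) (ε-+ j (+ 1) (+ m) f))
            (lemma (ε i (+ 1) f) (ε i (+ m) f) (ε j (+ 1) f) (ε j (+ m) f))
    where
    lemma : ∀ a b c d → (a ℤ.+ b) ℤ.- (c ℤ.+ d) ≡ (a ℤ.- c) ℤ.+ (b ℤ.- d)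
    lemma = solve-∀

  raise-suc : ∀ x m (γ : Fin ℓ → ℤ) → raise x (suc m) γ ≗ raise x m (raise x 1 γ)
  raise-suc x m γ f = begin
    raise x (suc m) γ f                            ≡⟨ raise-apply x (suc m) γ f ⟩
    γ f ℤ.+ raiseε x (suc m) f                     ≡⟨ ≡.cong (ℤ._+_ (γ f)) (raiseε-suc x m f) ⟩
    γ f ℤ.+ (raiseε x 1 f ℤ.+ raiseε x m f)        ≡⟨ ℤP.+-assoc (γ f) _ _ ⟨
    (γ f ℤ.+ raiseε x 1 f) ℤ.+ raiseε x m f        ≡⟨ ≡.cong (ℤ._+ raiseε x m f) (raise-apply x 1 γ f) ⟨
    raise x 1 γ f ℤ.+ raiseε x m f                 ≡⟨ raise-apply x m (raise x 1 γ) f ⟨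
    raise x m (raise x 1 γ) f                      ∎
    where open ≡.≡-Reasoning

_≟ᴿ_ : (x y : Root) → Dec (x ≡ y)
_≟ᴿ_ = ×P.≡-dec ℕ._≟_ ℕ._≟_

swapRoot : ℕ → Root → Root
swapRoot p (i , j) = (swapAdj p i , swapAdj p j)

swapRoot-involutive : ∀ p x → swapRoot p (swapRoot p x) ≡ x
swapRoot-involutive p (i , j) = ≡.cong₂ _,_ (swapAdj-involutive p i) (swapAdj-involutive p j)

swapRoot-injective : ∀ p {x y} → swapRoot p x ≡ swapRoot p y → x ≡ y
swapRoot-injective p {x} {y} e =
  ≡.trans (≡.sym (swapRoot-involutive p x)) (≡.trans (≡.cong (swapRoot p) e) (swapRoot-involutive p y))

module _ {ℓ : ℕ} (r : ℕ) where

  -- The dot action γ ↦ s(γ - ρ) + ρ of the transposition s = (r+1 r+2), with ρ = (0, 1, …, ℓ-1);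
  -- it permutes the rows of the Jacobi–Trudi matrix of γ.
  dotSwap : (Fin ℓ → ℤ) → Fin ℓ → ℤ
  dotSwap γ f = (γ (swapFin r f) ℤ.- + toℕ (swapFin r f)) ℤ.+ + toℕ f

  DotSwapFixed : (Fin ℓ → ℤ) → Set
  DotSwapFixed γ = dotSwap γ ≗ γ

module _ {ℓ : ℕ} (r : ℕ) (r+1<ℓ : suc r ℕ.< ℓ) where

  ε-swapFin : ∀ a c f → ε a c (swapFin r f) ≡ ε (swapAdj (suc r) a) c f
  ε-swapFin a c f = ≡.cong (λ b → if b then c else + 0)
    (≡.trans (≡.cong (λ x → suc x ℕ.≡ᵇ a) (toℕ-swapFin r f r+1<ℓ)) (swapAdj-≡ᵇ (suc r) (suc (toℕ f)) a))

  dotSwap-raise : ∀ x m (γ : Fin ℓ → ℤ) → dotSwap r (raise x m γ) ≗ raise (swapRoot (suc r) x) m (dotSwap r γ)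
  dotSwap-raise x@(i , j) m γ f = begin
    dotSwap r (raise x m γ) f
      ≡⟨ ≡.cong (λ u → (u ℤ.- + toℕ g) ℤ.+ + toℕ f) (raise-apply x m γ g) ⟩
    ((γ g ℤ.+ raiseε x m g) ℤ.- + toℕ g) ℤ.+ + toℕ f
      ≡⟨ ≡.cong (λ u → ((γ g ℤ.+ u) ℤ.- + toℕ g) ℤ.+ + toℕ f)
           (≡.cong₂ ℤ._-_ (ε-swapFin i (+ m) f) (ε-swapFin j (+ m) f)) ⟩
    ((γ g ℤ.+ ρ) ℤ.- + toℕ g) ℤ.+ + toℕ f
      ≡⟨ lemma (γ g) ρ (+ toℕ g) (+ toℕ f) ⟩
    dotSwap r γ f ℤ.+ ρ
      ≡⟨ raise-apply (swapRoot (suc r) x) m (dotSwap r γ) f ⟨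
    raise (swapRoot (suc r) x) m (dotSwap r γ) f ∎
    where
    open ≡.≡-Reasoning
    g = swapFin r f
    ρ = raiseε (swapRoot (suc r) x) m f
    lemma : ∀ a b c d → ((a ℤ.+ b) ℤ.- c) ℤ.+ d ≡ ((a ℤ.- c) ℤ.+ d) ℤ.+ b
    lemma = solve-∀

  dotSwap-fixed : ∀ (γ : Fin ℓ → ℤ) → γ ⟨ suc (suc r) ⟩ ≡ γ ⟨ suc r ⟩ ℤ.+ + 1 → DotSwapFixed r γ
  dotSwap-fixed γ γr+2≡γr+1+1 f = ≡.trans (≡.cong (ℤ._+ + toℕ f) κ-invariant) (cancel (γ f) (+ toℕ f))
    where
    κ : Fin ℓ → ℤ
    κ u = γ u ℤ.- + toℕ u
    cancel : ∀ a b → (a ℤ.- b) ℤ.+ b ≡ a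
    cancel = solve-∀
    κ-adjacent : ∀ u v → toℕ u ≡ r → toℕ v ≡ suc r → κ v ≡ κ u
    κ-adjacent u v ≡.refl v≡ = begin
      γ v ℤ.- + toℕ v                  ≡⟨ ≡.cong₂ (λ w t → w ℤ.- + t) γv≡ v≡ ⟩
      (γ u ℤ.+ + 1) ℤ.- + suc (toℕ u)  ≡⟨ shift (γ u) (+ toℕ u) ⟩
      γ u ℤ.- + toℕ u                  ∎
      where
      open ≡.≡-Reasoning
      shift : ∀ a b → (a ℤ.+ + 1) ℤ.- (+ 1 ℤ.+ b) ≡ a ℤ.- b
      shift = solve-∀
      γv≡ : γ v ≡ γ u ℤ.+ + 1
      γv≡ = ≡.trans (≡.sym (⟨⟩-toℕ γ v)) (≡.trans (≡.cong (λ t → γ ⟨ suc t ⟩) v≡)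
              (≡.trans γr+2≡γr+1+1 (≡.cong (ℤ._+ + 1) (⟨⟩-toℕ γ u))))
    κ-invariant : κ (swapFin r f) ≡ κ f
    κ-invariant with toℕ f ℕ.≟ r | toℕ f ℕ.≟ suc r
    ... | yes f≡r | _ = κ-adjacent f (swapFin r f) f≡r
          (≡.trans (toℕ-swapFin r f r+1<ℓ) (≡.trans (≡.cong (swapAdj r) f≡r) (swapAdj-self r)))
    ... | no _ | yes f≡r+1 = ≡.sym (κ-adjacent (swapFin r f) f
          (≡.trans (toℕ-swapFin r f r+1<ℓ) (≡.trans (≡.cong (swapAdj r) f≡r+1) (swapAdj-suc r))) f≡r+1)
    ... | no f≢r | no f≢r+1 = ≡.cong κ (FinP.toℕ-injective
          (≡.trans (toℕ-swapFin r f r+1<ℓ) (swapAdj-other r (toℕ f) f≢r f≢r+1)))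

oneTo-complete : ∀ n {x} → 1 ℕ.≤ x → x ℕ.≤ n → x ∈ oneTo n
oneTo-complete (suc n) {x} 1≤x x≤1+n with x ℕ.≟ suc n
... | yes ≡.refl = ∈-++⁺ʳ (oneTo n) (here ≡.refl)
... | no x≢1+n = ∈-++⁺ˡ (oneTo-complete n 1≤x (ℕP.≤-pred (ℕP.≤∧≢⇒< x≤1+n x≢1+n)))
oneTo-complete zero (s≤s _) ()

oneTo-bounded : ∀ n {x} → x ∈ oneTo n → x ℕ.≤ n
oneTo-bounded (suc n) x∈ with ∈-++⁻ (oneTo n) x∈
... | inj₁ x∈′ = ℕP.m≤n⇒m≤1+n (oneTo-bounded n x∈′)
... | inj₂ (here ≡.refl) = ℕP.≤-refl

oneTo-unique : ∀ n → Unique (oneTo n)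
oneTo-unique zero = []
oneTo-unique (suc n) = UniqueP.++⁺ (oneTo-unique n) ([] ∷ [])
  (λ { (x∈ , here ≡.refl) → ℕP.<-irrefl ≡.refl (oneTo-bounded n x∈) })

allPairs-cartesianProduct : ∀ ℓ → allPairs ℓ ≡ cartesianProduct (oneTo ℓ) (oneTo ℓ)
allPairs-cartesianProduct ℓ = go (oneTo ℓ)
  where
  go : ∀ xs → concatMap (λ i → map (λ j → (i , j)) (oneTo ℓ)) xs ≡ cartesianProduct xs (oneTo ℓ)
  go [] = ≡.refl
  go (x ∷ xs) = ≡.cong (map (λ j → (x , j)) (oneTo ℓ) ++_) (go xs)

allPairs-unique : ∀ ℓ → Unique (allPairs ℓ)
allPairs-unique ℓ = ≡.subst Unique (≡.sym (allPairs-cartesianProduct ℓ))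
  (UniqueP.cartesianProduct⁺ (oneTo-unique ℓ) (oneTo-unique ℓ))

Pos⇒∈allPairs : ∀ ℓ {x} → Pos ℓ x → x ∈ allPairs ℓ
Pos⇒∈allPairs ℓ (1≤i , i<j , j≤ℓ) = ≡.subst (_ ∈_) (≡.sym (allPairs-cartesianProduct ℓ))
  (∈-cartesianProduct⁺ (oneTo-complete ℓ 1≤i (ℕP.≤-trans (ℕP.<⇒≤ i<j) j≤ℓ))
                       (oneTo-complete ℓ (ℕP.≤-trans 1≤i (ℕP.<⇒≤ i<j)) j≤ℓ))

module _ {a p q} {A : Set a} {P : Pred A p} {Q : Pred A q} (P? : Decidable P) (Q? : Decidable Q) where

  filter-cong-∈ : ∀ xs → (∀ {y} → y ∈ xs → P y → Q y) → (∀ {y} → Q y → P y) → filter P? xs ≡ filter Q? xs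
  filter-cong-∈ [] _ _ = ≡.refl
  filter-cong-∈ (y ∷ ys) P⇒Q Q⇒P with P? y
  ... | yes Py = ≡.trans (≡.cong (y ∷_) (filter-cong-∈ ys (P⇒Q ∘ there) Q⇒P))
                         (≡.sym (ListP.filter-accept Q? (P⇒Q (here ≡.refl) Py)))
  ... | no ¬Py = ≡.trans (filter-cong-∈ ys (P⇒Q ∘ there) Q⇒P) (≡.sym (ListP.filter-reject Q? (¬Py ∘ Q⇒P)))

  filter-insert-↭ : ∀ {x} xs → Unique xs → x ∈ xs → P x → ¬ Q x
    → (∀ {y} → P y → y ≢ x → Q y) → (∀ {y} → Q y → P y) → filter P? xs ↭ x ∷ filter Q? xs
  filter-insert-↭ (x ∷ ys) (x∉ys ∷ _) (here ≡.refl) Px ¬Qx P⇒Q Q⇒P =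
    ≡.subst₂ _↭_ (≡.sym (ListP.filter-accept P? Px))
      (≡.cong (x ∷_) (≡.trans (filter-cong-∈ ys (λ y∈ Py → P⇒Q Py (All.lookup x∉ys y∈ ∘ ≡.sym)) Q⇒P)
                              (≡.sym (ListP.filter-reject Q? ¬Qx))))
      Perm.refl
  filter-insert-↭ (y ∷ ys) (y∉ys ∷ u) (there x∈ys) Px ¬Qx P⇒Q Q⇒P with P? y
  ... | yes Py = ≡.subst (λ l → y ∷ filter P? ys ↭ _ ∷ l) (≡.sym (ListP.filter-accept Q? Qy))
      (Perm.trans (Perm.prep y (filter-insert-↭ ys u x∈ys Px ¬Qx P⇒Q Q⇒P)) (Perm.swap y _ Perm.refl))
    where
    Qy : Q y
    Qy = P⇒Q Py (All.lookup y∉ys x∈ys)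
  ... | no ¬Py = ≡.subst (λ l → filter P? ys ↭ _ ∷ l) (≡.sym (ListP.filter-reject Q? (¬Py ∘ Q⇒P)))
      (filter-insert-↭ ys u x∈ys Px ¬Qx P⇒Q Q⇒P)

SwapClosed : ℕ → List Root → Set
SwapClosed p L = ∀ {x} → x ∈ L → swapRoot p x ∈ L

module _ {p : ℕ} where
  open import Data.List.Relation.Binary.Permutation.Setoid.Properties (≡.setoid Root) using (Unique-resp-↭)

  SwapClosed-↭ : ∀ {L L′} → L ↭ L′ → SwapClosed p L → SwapClosed p L′
  SwapClosed-↭ L↭L′ closed x∈L′ = PermP.∈-resp-↭ L↭L′ (closed (PermP.∈-resp-↭ (Perm.↭-sym L↭L′) x∈L′))

  SwapClosed-fixed-tail : ∀ {x L} → swapRoot p x ≡ x → Unique (x ∷ L) → SwapClosed p (x ∷ L) → SwapClosed p L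
  SwapClosed-fixed-tail {x} {L} σx≡x (x∉L ∷ _) closed {y} y∈L with closed (there y∈L)
  ... | here σy≡x = ⊥-elim (All.lookup x∉L y∈L
                              (swapRoot-injective p (≡.trans σx≡x (≡.sym σy≡x))))
  ... | there σy∈L = σy∈L

  SwapClosed-partner : ∀ {x L} → swapRoot p x ≢ x → Unique (x ∷ L) → SwapClosed p (x ∷ L)
    → ∃₂ λ L′ (_ : L ↭ swapRoot p x ∷ L′) → Unique (x ∷ swapRoot p x ∷ L′) × SwapClosed p L′
  SwapClosed-partner {x} {L} σx≢x u closed with closed (here ≡.refl)
  ... | here σx≡x = ⊥-elim (σx≢x σx≡x)
  ... | there σx∈L with ∈-∃++ σx∈L
  ... | before , after , ≡.refl = L′ , L↭ , u′ , closed′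
    where
    L′ = before ++ after
    L↭ : before ++ swapRoot p x ∷ after ↭ swapRoot p x ∷ L′
    L↭ = PermP.shift (swapRoot p x) before after
    u′ : Unique (x ∷ swapRoot p x ∷ L′)
    u′ = Unique-resp-↭ (↭⇒↭ₛ (Perm.prep x L↭)) u
    x∉L′ : All (x ≢_) L′
    x∉L′ with u′
    ... | (_ ∷ x∉) ∷ _ = x∉
    σx∉L′ : All (swapRoot p x ≢_) L′
    σx∉L′ with u′
    ... | _ ∷ σx∉ ∷ _ = σx∉
    closed′ : SwapClosed p L′
    closed′ {y} y∈L′ with SwapClosed-↭ (Perm.prep x L↭) closed (there (there y∈L′))
    ... | here σy≡x = ⊥-elim (All.lookup σx∉L′ y∈L′
                              (≡.trans (≡.cong (swapRoot p) (≡.sym σy≡x)) (swapRoot-involutive p y)))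
    ... | there (here σy≡σx) = ⊥-elim (All.lookup x∉L′ y∈L′ (≡.sym (swapRoot-injective p σy≡σx)))
    ... | there (there σy∈L′) = σy∈L′

module Symmetric {c ℓ′ : Level} (R : CommutativeRing c ℓ′) (h : ℕ → CommutativeRing.Carrier R) where
  open CommutativeRing R hiding (zero)
  open Sym R h
  open import Algebra.Properties.Ring ring using (-‿involutive; -‿+-comm; -0#≈0#; -‿distribʳ-*)
  open import Algebra.Properties.CommutativeSemigroup +-commutativeSemigroup using (interchange)
  open import Algebra.Properties.CommutativeSemigroup *-commutativeSemigroup using (x∙yz≈y∙xz)
  open import Relation.Binary.Reasoning.Setoid setoid

  -‿+ : ∀ x y → - (x + y) ≈ - x + - y
  -‿+ x y = sym (-‿+-comm x y)

  sumFin-cong : ∀ n {f g : Fin n → Carrier} → (∀ i → f i ≈ g i) → sumFin n f ≈ sumFin n g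
  sumFin-cong zero _ = refl
  sumFin-cong (suc n) f≈g = +-cong (f≈g zero) (sumFin-cong n (f≈g ∘ suc))

  sumFin-+ : ∀ n (f g : Fin n → Carrier) → sumFin n (λ i → f i + g i) ≈ sumFin n f + sumFin n g
  sumFin-+ zero _ _ = sym (+-identityˡ 0#)
  sumFin-+ (suc n) f g = trans (+-congˡ (sumFin-+ n (f ∘ suc) (g ∘ suc))) (interchange _ _ _ _)

  sumFin-neg : ∀ n (f : Fin n → Carrier) → sumFin n (λ i → - f i) ≈ - sumFin n f
  sumFin-neg zero _ = sym -0#≈0#
  sumFin-neg (suc n) f = trans (+-congˡ (sumFin-neg n (f ∘ suc))) (sym (-‿+ _ _))

  sumFin-≈- : ∀ n {f} (g : Fin n → Carrier) → (∀ i → f i ≈ - g i) → sumFin n f ≈ - sumFin n g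
  sumFin-≈- n g f≈-g = trans (sumFin-cong n f≈-g) (sumFin-neg n g)

  sumFin-0# : ∀ n (f : Fin n → Carrier) → (∀ i → f i ≈ 0#) → sumFin n f ≈ 0#
  sumFin-0# zero _ _ = refl
  sumFin-0# (suc n) f f≈0 = trans (+-cong (f≈0 zero) (sumFin-0# n (f ∘ suc) (f≈0 ∘ suc))) (+-identityˡ 0#)

  *-sumFin : ∀ n x (f : Fin n → Carrier) → x * sumFin n f ≈ sumFin n (λ i → x * f i)
  *-sumFin zero x _ = zeroʳ x
  *-sumFin (suc n) x f = trans (distribˡ x _ _) (+-congˡ (*-sumFin n x (f ∘ suc)))

  alt-cong : ∀ k {x y} → x ≈ y → alt k x ≈ alt k y
  alt-cong zero x≈y = x≈y
  alt-cong (suc k) x≈y = -‿cong (alt-cong k x≈y)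

  alt-neg : ∀ k x → alt k (- x) ≈ - alt k x
  alt-neg zero _ = refl
  alt-neg (suc k) x = -‿cong (alt-neg k x)

  alt-0# : ∀ k → alt k 0# ≈ 0#
  alt-0# zero = refl
  alt-0# (suc k) = trans (-‿cong (alt-0# k)) -0#≈0#

  alt-+ : ∀ k x y → alt k (x + y) ≈ alt k x + alt k y
  alt-+ zero _ _ = refl
  alt-+ (suc k) x y = trans (-‿cong (alt-+ k x y)) (-‿+ _ _)

  alt-sumFin : ∀ k n (f : Fin n → Carrier) → alt k (sumFin n f) ≈ sumFin n (λ i → alt k (f i))
  alt-sumFin k zero _ = alt-0# k
  alt-sumFin k (suc n) f = trans (alt-+ k _ _) (+-congˡ (alt-sumFin k n (f ∘ suc)))

  *-alt : ∀ k x y → x * alt k y ≈ alt k (x * y)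
  *-alt zero _ _ = refl
  *-alt (suc k) x y = trans (sym (-‿distribʳ-* x (alt k y))) (-‿cong (*-alt k x y))

  alt-alt : ∀ j k x → alt j (alt k x) ≈ alt (j ℕ.+ k) x
  alt-alt zero _ _ = refl
  alt-alt (suc j) k x = -‿cong (alt-alt j k x)

  alt-≡suc : ∀ {j k} x → j ≡ suc k → alt j x ≈ - alt k x
  alt-≡suc _ ≡.refl = refl

  sumDistinctPairs : ∀ m → (Fin (suc m) → Fin (suc m) → Carrier) → Carrier
  sumDistinctPairs m F = sumFin (suc m) (λ u → sumFin m (λ c → F u (punchIn u c)))

  sumDistinctPairs-suc : ∀ m F → sumDistinctPairs (suc m) F ≈
     (sumFin (suc m) (λ c → F zero (suc c)) + sumFin (suc m) (λ u → F (suc u) zero))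
       + sumDistinctPairs m (λ u v → F (suc u) (suc v))
  sumDistinctPairs-suc m F =
    trans (+-congˡ (sumFin-+ (suc m) (λ u → F (suc u) zero) (λ u → sumFin m (λ c → F (suc u) (suc (punchIn u c))))))
          (sym (+-assoc _ _ _))

  sumDistinctPairs-flip : ∀ m (F G : Fin (suc m) → Fin (suc m) → Carrier)
    → (∀ u c → G u (punchIn u c) ≈ - F (punchIn u c) u) → sumDistinctPairs m G ≈ - sumDistinctPairs m F
  sumDistinctPairs-flip zero _ _ _ = trans (+-identityˡ 0#) (sym (trans (-‿cong (+-identityˡ 0#)) -0#≈0#))
  sumDistinctPairs-flip (suc m) F G G≈-F = begin
    sumDistinctPairs (suc m) G               ≈⟨ sumDistinctPairs-suc m G ⟩
    (row G + column G) + rest G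
      ≈⟨ +-cong (+-cong (sumFin-≈- (suc m) (λ c → F (suc c) zero) (G≈-F zero))
                        (sumFin-≈- (suc m) (λ c → F zero (suc c)) (λ u → G≈-F (suc u) zero)))
                (sumDistinctPairs-flip m (λ u v → F (suc u) (suc v)) (λ u v → G (suc u) (suc v))
                                         (λ u c → G≈-F (suc u) (suc c))) ⟩
    (- column F + - row F) + - rest F        ≈⟨ +-congʳ (+-comm _ _) ⟩
    (- row F + - column F) + - rest F        ≈⟨ +-congʳ (sym (-‿+ _ _)) ⟩
    - (row F + column F) + - rest F          ≈⟨ sym (-‿+ _ _) ⟩
    - ((row F + column F) + rest F)          ≈⟨ -‿cong (sym (sumDistinctPairs-suc m F)) ⟩
    - sumDistinctPairs (suc m) F             ∎
    where
    row column : (Fin (suc (suc m)) → Fin (suc (suc m)) → Carrier) → Carrier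
    row H = sumFin (suc m) (λ c → H zero (suc c))
    column H = sumFin (suc m) (λ u → H (suc u) zero)
    rest : (Fin (suc (suc m)) → Fin (suc (suc m)) → Carrier) → Carrier
    rest H = sumDistinctPairs m (λ u v → H (suc u) (suc v))

  sumDistinctPairs-alternating : ∀ m (F : Fin (suc m) → Fin (suc m) → Carrier)
    → (∀ u c → F u (punchIn u c) ≈ - F (punchIn u c) u) → sumDistinctPairs m F ≈ 0#
  sumDistinctPairs-alternating zero _ _ = +-identityˡ 0#
  sumDistinctPairs-alternating (suc m) F F≈-F = begin
    sumDistinctPairs (suc m) F         ≈⟨ sumDistinctPairs-suc m F ⟩
    (row + column) + rest
      ≈⟨ +-cong (+-congˡ (sumFin-≈- (suc m) (λ c → F zero (suc c)) (λ u → F≈-F (suc u) zero)))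
                (sumDistinctPairs-alternating m (λ u v → F (suc u) (suc v)) (λ u c → F≈-F (suc u) (suc c))) ⟩
    (row + - row) + 0#                 ≈⟨ +-identityʳ _ ⟩
    row + - row                        ≈⟨ -‿inverseʳ row ⟩
    0#                                 ∎
    where
    row = sumFin (suc m) (λ c → F zero (suc c))
    column = sumFin (suc m) (λ u → F (suc u) zero)
    rest = sumDistinctPairs m (λ u v → F (suc u) (suc v))

  Matrix : ℕ → Set c
  Matrix n = Fin n → Fin n → Carrier

  det-cong : ∀ n {M N : Matrix n} → (∀ i j → M i j ≈ N i j) → det n M ≈ det n N
  det-cong zero _ = refl
  det-cong (suc n) M≈N = sumFin-cong (suc n) (λ j →
    alt-cong (toℕ j) (*-cong (M≈N zero j) (det-cong n (λ r c → M≈N (suc r) (punchIn j c)))))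

  minor₂ : ∀ m → Matrix (suc (suc m)) → Fin (suc (suc m)) → Fin (suc (suc m)) → Carrier
  minor₂ m M u v = det m (λ r c → M (suc (suc r)) (punchIn u (punchIn (punchOut₀ u v) c)))

  laplace₂ : ∀ m → Matrix (suc (suc m)) → Fin (suc (suc m)) → Fin (suc (suc m)) → Carrier
  laplace₂ m M u v = alt (toℕ u ℕ.+ toℕ (punchOut₀ u v)) (M zero u * (M (suc zero) v * minor₂ m M u v))

  det-laplace₂ : ∀ m M → det (suc (suc m)) M ≈ sumDistinctPairs (suc m) (laplace₂ m M)
  det-laplace₂ m M = sumFin-cong (suc (suc m)) (λ j → begin
    alt (toℕ j) (M zero j * det (suc m) (λ r c → M (suc r) (punchIn j c)))
      ≈⟨ alt-cong (toℕ j) (*-sumFin (suc m) (M zero j) (λ c → alt (toℕ c) (X j c))) ⟩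
    alt (toℕ j) (sumFin (suc m) (λ c → M zero j * alt (toℕ c) (X j c)))
      ≈⟨ alt-sumFin (toℕ j) (suc m) (λ c → M zero j * alt (toℕ c) (X j c)) ⟩
    sumFin (suc m) (λ c → alt (toℕ j) (M zero j * alt (toℕ c) (X j c)))
      ≈⟨ sumFin-cong (suc m) (λ c → trans (alt-cong (toℕ j) (*-alt (toℕ c) (M zero j) (X j c)))
                                          (trans (alt-alt (toℕ j) (toℕ c) _) (reflexive (≡.sym (laplace₂-punchIn j c))))) ⟩
    sumFin (suc m) (λ c → laplace₂ m M j (punchIn j c)) ∎)
    where
    X : Fin (suc (suc m)) → Fin (suc m) → Carrier
    X j c = M (suc zero) (punchIn j c) * det m (λ r c′ → M (suc (suc r)) (punchIn j (punchIn c c′)))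
    laplace₂-punchIn : ∀ j c → laplace₂ m M j (punchIn j c) ≡ alt (toℕ j ℕ.+ toℕ c) (M zero j * X j c)
    laplace₂-punchIn j c rewrite punchOut₀-punchIn j c = ≡.refl

  minor₂-comm : ∀ m M (u v : Fin (suc (suc m))) → u ≢ v → minor₂ m M u v ≈ minor₂ m M v u
  minor₂-comm m M u v u≢v =
    det-cong m (λ r c → reflexive (≡.cong (M (suc (suc r))) (punchIn-punchOut₀-comm u v u≢v c)))

  laplace₂-reorder : ∀ m M (u v : Fin (suc (suc m))) → u ≢ v
    → M (suc zero) u * (M zero v * minor₂ m M u v) ≈ M zero v * (M (suc zero) u * minor₂ m M v u)
  laplace₂-reorder m M u v u≢v =
    trans (x∙yz≈y∙xz (M (suc zero) u) (M zero v) _) (*-congˡ (*-congˡ (minor₂-comm m M u v u≢v)))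

  laplace₂-swapRows : ∀ m M (u v : Fin (suc (suc m))) → u ≢ v
    → laplace₂ m (M ∘ swapFin 0) u v ≈ - laplace₂ m M v u
  laplace₂-swapRows m M u v u≢v with punchOut₀-parity u v u≢v
  ... | inj₁ e = trans (alt-≡suc _ e)
                       (-‿cong (alt-cong (toℕ v ℕ.+ toℕ (punchOut₀ v u)) (laplace₂-reorder m M u v u≢v)))
  ... | inj₂ e = trans (alt-cong (toℕ u ℕ.+ toℕ (punchOut₀ u v)) (laplace₂-reorder m M u v u≢v))
                       (trans (sym (-‿involutive _)) (-‿cong (sym (alt-≡suc _ e))))

  -- By induction on r: swapFin (suc r) fixes row 0 and acts as swapFin r on the minors;
  -- for r = 0 expand along the first two rows.
  det-swapRows : ∀ n r → suc r ℕ.< n → ∀ (M : Matrix n) → det n (M ∘ swapFin r) ≈ - det n M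
  det-swapRows (suc (suc m)) zero _ M = begin
    det (suc (suc m)) (M ∘ swapFin 0)
      ≈⟨ det-laplace₂ m (M ∘ swapFin 0) ⟩
    sumDistinctPairs (suc m) (laplace₂ m (M ∘ swapFin 0))
      ≈⟨ sumDistinctPairs-flip (suc m) (laplace₂ m M) (laplace₂ m (M ∘ swapFin 0))
           (λ j c → laplace₂-swapRows m M j (punchIn j c) (punchIn-≢ j c)) ⟩
    - sumDistinctPairs (suc m) (laplace₂ m M)
      ≈⟨ -‿cong (det-laplace₂ m M) ⟨
    - det (suc (suc m)) M ∎
  det-swapRows (suc n) (suc r) (s≤s r+1<n) M = begin
    sumFin (suc n) (λ j → alt (toℕ j) (M zero j * det n (minor j ∘ swapFin r)))
      ≈⟨ sumFin-cong (suc n) (λ j → alt-cong (toℕ j) (*-congˡ {M zero j} (det-swapRows n r r+1<n (minor j)))) ⟩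
    sumFin (suc n) (λ j → alt (toℕ j) (M zero j * - det n (minor j)))
      ≈⟨ sumFin-cong (suc n) (λ j → trans (alt-cong (toℕ j) (sym (-‿distribʳ-* (M zero j) (det n (minor j)))))
                                          (alt-neg (toℕ j) (M zero j * det n (minor j)))) ⟩
    sumFin (suc n) (λ j → - alt (toℕ j) (M zero j * det n (minor j)))
      ≈⟨ sumFin-neg (suc n) (λ j → alt (toℕ j) (M zero j * det n (minor j))) ⟩
    - det (suc n) M ∎
    where
    minor : Fin (suc n) → Matrix n
    minor j r c = M (suc r) (punchIn j c)

  det-swapRows-invariant : ∀ n r → suc r ℕ.< n → ∀ (M : Matrix n)
    → (∀ i j → M (swapFin r i) j ≈ M i j) → det n M ≈ 0#
  det-swapRows-invariant (suc (suc m)) zero _ M M∘s≈M =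
    trans (det-laplace₂ m M) (sumDistinctPairs-alternating (suc m) (laplace₂ m M) (λ j c →
      trans (sym (laplace₂-cong j (punchIn j c))) (laplace₂-swapRows m M j (punchIn j c) (punchIn-≢ j c))))
    where
    laplace₂-cong : ∀ u v → laplace₂ m (M ∘ swapFin 0) u v ≈ laplace₂ m M u v
    laplace₂-cong u v =
      alt-cong (toℕ u ℕ.+ toℕ (punchOut₀ u v)) (*-cong (M∘s≈M zero u) (*-congʳ (M∘s≈M (suc zero) v)))
  det-swapRows-invariant (suc n) (suc r) (s≤s r+1<n) M M∘s≈M =
    sumFin-0# (suc n) (λ j → alt (toℕ j) (M zero j * det n (minor j))) (λ j → trans (alt-cong (toℕ j)
      (trans (*-congˡ (det-swapRows-invariant n r r+1<n (minor j) (λ i c → M∘s≈M (suc i) (punchIn j c))))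
             (zeroʳ (M zero j))))
      (alt-0# (toℕ j)))
    where
    minor : Fin (suc n) → Matrix n
    minor j r c = M (suc r) (punchIn j c)

  jacobiTrudi : ∀ {ℓ} → (Fin ℓ → ℤ) → Matrix ℓ
  jacobiTrudi γ i j = hZ ((γ i ℤ.+ + toℕ j) ℤ.- + toℕ i)

  s-cong : ∀ {ℓ} {γ γ′ : Fin ℓ → ℤ} → γ ≗ γ′ → s γ ≈ s γ′
  s-cong {ℓ} γ≗γ′ = det-cong ℓ (λ i j → reflexive (≡.cong (λ u → hZ ((u ℤ.+ + toℕ j) ℤ.- + toℕ i)) (γ≗γ′ i)))

  jacobiTrudi-dotSwap : ∀ {ℓ} r (γ : Fin ℓ → ℤ) i j → jacobiTrudi (dotSwap r γ) i j ≡ jacobiTrudi γ (swapFin r i) j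
  jacobiTrudi-dotSwap r γ i j = ≡.cong hZ (cancel (γ (swapFin r i)) (+ toℕ (swapFin r i)) (+ toℕ i) (+ toℕ j))
    where
    cancel : ∀ a b c d → (((a ℤ.- b) ℤ.+ c) ℤ.+ d) ℤ.- c ≡ (a ℤ.+ d) ℤ.- b
    cancel = solve-∀

  s-dotSwap : ∀ {ℓ} r → suc r ℕ.< ℓ → (γ : Fin ℓ → ℤ) → s (dotSwap r γ) ≈ - s γ
  s-dotSwap {ℓ} r r+1<ℓ γ =
    trans (det-cong ℓ (λ i j → reflexive (jacobiTrudi-dotSwap r γ i j))) (det-swapRows ℓ r r+1<ℓ (jacobiTrudi γ))

  s-dotSwapFixed : ∀ {ℓ} r → suc r ℕ.< ℓ → (γ : Fin ℓ → ℤ) → DotSwapFixed r γ → s γ ≈ 0#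
  s-dotSwapFixed {ℓ} r r+1<ℓ γ fixed = det-swapRows-invariant ℓ r r+1<ℓ (jacobiTrudi γ) (λ i j →
    reflexive (≡.trans (≡.sym (jacobiTrudi-dotSwap r γ i j)) (≡.cong (λ u → hZ ((u ℤ.+ + toℕ j) ℤ.- + toℕ i)) (fixed i))))

  sumTo-cong : ∀ n {f g : ℕ → Carrier} → (∀ m → m ℕ.≤ n → f m ≈ g m) → sumTo n f ≈ sumTo n g
  sumTo-cong zero f≈g = f≈g 0 z≤n
  sumTo-cong (suc n) f≈g = +-cong (sumTo-cong n (λ m m≤n → f≈g m (ℕP.m≤n⇒m≤1+n m≤n))) (f≈g (suc n) ℕP.≤-refl)

  sumTo-+ : ∀ n (f g : ℕ → Carrier) → sumTo n (λ m → f m + g m) ≈ sumTo n f + sumTo n g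
  sumTo-+ zero _ _ = refl
  sumTo-+ (suc n) f g = trans (+-congʳ (sumTo-+ n f g)) (interchange _ _ _ _)

  sumTo-neg : ∀ n (f : ℕ → Carrier) → sumTo n (λ m → - f m) ≈ - sumTo n f
  sumTo-neg zero _ = refl
  sumTo-neg (suc n) f = trans (+-congʳ (sumTo-neg n f)) (sym (-‿+ _ _))

  sumTo-0# : ∀ n (f : ℕ → Carrier) → (∀ m → m ℕ.≤ n → f m ≈ 0#) → sumTo n f ≈ 0#
  sumTo-0# n f f≈0 = trans (sumTo-cong n f≈0) (zeros n)
    where
    zeros : ∀ n → sumTo n (λ _ → 0#) ≈ 0#
    zeros zero = refl
    zeros (suc n) = trans (+-congʳ (zeros n)) (+-identityˡ 0#)

  sumTo-suc : ∀ n (f : ℕ → Carrier) → sumTo (suc n) f ≈ f 0 + sumTo n (f ∘ suc)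
  sumTo-suc zero _ = refl
  sumTo-suc (suc n) f = trans (+-congʳ (sumTo-suc n f)) (+-assoc _ _ _)

  sumTo-reverse : ∀ n (f : ℕ → Carrier) → sumTo n f ≈ sumTo n (λ m → f (n ∸ m))
  sumTo-reverse zero _ = refl
  sumTo-reverse (suc n) f =
    trans (+-congʳ (sumTo-reverse n f)) (trans (+-comm _ _) (sym (sumTo-suc n (λ m → f (suc n ∸ m)))))

  sumTo-antipalindromic : ∀ d (g : ℕ → Carrier) → (∀ a → a ℕ.≤ d → g a ≈ - g (d ∸ a))
    → (∀ a → a ℕ.+ a ≡ d → g a ≈ 0#) → sumTo d g ≈ 0#
  sumTo-antipalindromic zero g _ middle = middle 0 ≡.refl
  sumTo-antipalindromic (suc zero) g anti _ = trans (+-congʳ (anti 0 z≤n)) (-‿inverseˡ (g 1))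
  sumTo-antipalindromic (suc (suc d)) g anti middle = begin
    sumTo (suc (suc d)) g                       ≈⟨ sumTo-suc (suc d) g ⟩
    g 0 + (sumTo d (g ∘ suc) + g (suc (suc d)))  ≈⟨ +-congˡ (+-congʳ inner) ⟩
    g 0 + (0# + g (suc (suc d)))                 ≈⟨ +-congˡ (+-identityˡ _) ⟩
    g 0 + g (suc (suc d))                        ≈⟨ +-congʳ (anti 0 z≤n) ⟩
    - g (suc (suc d)) + g (suc (suc d))          ≈⟨ -‿inverseˡ _ ⟩
    0#                                           ∎
    where
    inner : sumTo d (g ∘ suc) ≈ 0#
    inner = sumTo-antipalindromic d (g ∘ suc)
      (λ a a≤d → trans (anti (suc a) (s≤s (ℕP.m≤n⇒m≤1+n a≤d))) (-‿cong (reflexive (≡.cong g (ℕP.+-∸-assoc 1 a≤d)))))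
      (λ a e → middle (suc a) (≡.cong suc (≡.trans (ℕP.+-suc a a) (≡.cong suc e))))

  -- Σ_{a+b+c = n} F a b c, in the nesting produced by two consecutive roots in Hcoef.
  sumTriangle : ℕ → (ℕ → ℕ → ℕ → Carrier) → Carrier
  sumTriangle n F = sumTo n (λ a → sumTo (n ∸ a) (λ b → F a b (n ∸ a ∸ b)))

  sumAntidiagonals : ℕ → (ℕ → ℕ → ℕ → Carrier) → Carrier
  sumAntidiagonals n F = sumTo n (λ d → sumTo d (λ a → F a (d ∸ a) (n ∸ d)))

  sumTo-≡suc : ∀ {k k′} → k ≡ suc k′ → (H : ℕ → Carrier) → sumTo k H ≈ sumTo k′ H + H k
  sumTo-≡suc ≡.refl _ = refl

  sumTo-exchange : ∀ n (H : ℕ → ℕ → Carrier)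
    → sumTo n (λ a → sumTo (n ∸ a) (H a)) ≈ sumTo n (λ d → sumTo d (λ a → H a (d ∸ a)))
  sumTo-exchange zero _ = refl
  sumTo-exchange (suc n) H = begin
    sumTo n (λ a → sumTo (suc n ∸ a) (H a)) + sumTo (n ∸ n) (H (suc n))
      ≈⟨ +-cong (sumTo-cong n (λ a a≤n → sumTo-≡suc (ℕP.+-∸-assoc 1 a≤n) (H a)))
                (reflexive (≡.cong (λ k → sumTo k (H (suc n))) (ℕP.n∸n≡0 n))) ⟩
    sumTo n (λ a → sumTo (n ∸ a) (H a) + H a (suc n ∸ a)) + H (suc n) 0
      ≈⟨ +-congʳ (sumTo-+ n (λ a → sumTo (n ∸ a) (H a)) (λ a → H a (suc n ∸ a))) ⟩
    (sumTo n (λ a → sumTo (n ∸ a) (H a)) + sumTo n (λ a → H a (suc n ∸ a))) + H (suc n) 0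
      ≈⟨ +-congʳ (+-congʳ (sumTo-exchange n H)) ⟩
    (sumTo n (λ d → sumTo d (λ a → H a (d ∸ a))) + sumTo n (λ a → H a (suc n ∸ a))) + H (suc n) 0
      ≈⟨ +-assoc _ _ _ ⟩
    sumTo n (λ d → sumTo d (λ a → H a (d ∸ a))) + (sumTo n (λ a → H a (suc n ∸ a)) + H (suc n) 0)
      ≈⟨ +-congˡ (+-congˡ (reflexive (≡.cong (H (suc n)) (≡.sym (ℕP.n∸n≡0 n))))) ⟩
    sumTo (suc n) (λ d → sumTo d (λ a → H a (d ∸ a))) ∎

  sumTriangle-antidiagonals : ∀ n F → sumTriangle n F ≈ sumAntidiagonals n F
  sumTriangle-antidiagonals n F = trans (sumTo-exchange n (λ a b → F a b (n ∸ a ∸ b)))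
    (sumTo-cong n (λ d _ → sumTo-cong d (λ a a≤d → reflexive (≡.cong (F a (d ∸ a))
       (≡.trans (ℕP.∸-+-assoc n a (d ∸ a)) (≡.cong (n ∸_) (ℕP.m+[n∸m]≡n a≤d)))))))

  sumAntidiagonals-swap : ∀ n F → sumAntidiagonals n F ≈ sumAntidiagonals n (λ a b c → F b a c)
  sumAntidiagonals-swap n F = sumTo-cong n (λ d _ → trans (sumTo-reverse d (λ a → F a (d ∸ a) (n ∸ d)))
    (sumTo-cong d (λ a a≤d → reflexive (≡.cong (λ u → F (d ∸ a) u (n ∸ d)) (ℕP.m∸[m∸n]≡n a≤d)))))

  sumTriangle-swap : ∀ n F → sumTriangle n F ≈ sumTriangle n (λ a b c → F b a c)
  sumTriangle-swap n F = trans (sumTriangle-antidiagonals n F)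
    (trans (sumAntidiagonals-swap n F) (sym (sumTriangle-antidiagonals n (λ a b c → F b a c))))

  sumTriangle-alternating : ∀ n F → (∀ a b c → F a b c ≈ - F b a c) → (∀ a c → F a a c ≈ 0#)
    → sumTriangle n F ≈ 0#
  sumTriangle-alternating n F anti diagonal = trans (sumTriangle-antidiagonals n F)
    (sumTo-0# n _ (λ d _ → sumTo-antipalindromic d (λ a → F a (d ∸ a) (n ∸ d))
      (λ a a≤d → trans (anti a (d ∸ a) (n ∸ d))
                       (-‿cong (reflexive (≡.cong (λ u → F (d ∸ a) u (n ∸ d)) (≡.sym (ℕP.m∸[m∸n]≡n a≤d))))))
      (λ a a+a≡d → trans (reflexive (≡.cong (λ u → F a u (n ∸ d))
                                       (≡.trans (≡.cong (_∸ a) (≡.sym a+a≡d)) (ℕP.m+n∸m≡n a a))))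
                         (diagonal a (n ∸ d)))))

  sumTriangle-cong : ∀ n {F G} → (∀ a b c → F a b c ≈ G a b c) → sumTriangle n F ≈ sumTriangle n G
  sumTriangle-cong n F≈G = sumTo-cong n (λ a _ → sumTo-cong (n ∸ a) (λ b _ → F≈G a b _))

  sumTriangle-neg : ∀ n F → sumTriangle n (λ a b c → - F a b c) ≈ - sumTriangle n F
  sumTriangle-neg n F = trans (sumTo-cong n (λ a _ → sumTo-neg (n ∸ a) (λ b → F a b (n ∸ a ∸ b))))
                              (sumTo-neg n (λ a → sumTo (n ∸ a) (λ b → F a b (n ∸ a ∸ b))))

  Hcoef-cong : ∀ {ℓ} L {γ γ′ : Fin ℓ → ℤ} → γ ≗ γ′ → Hcoef L γ ≈ˢ Hcoef L γ′
  Hcoef-cong [] γ≗γ′ zero = s-cong γ≗γ′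
  Hcoef-cong [] γ≗γ′ (suc n) = refl
  Hcoef-cong (x ∷ L) γ≗γ′ n = sumTo-cong n (λ m _ → Hcoef-cong L (raise-cong x m γ≗γ′) (n ∸ m))

  Hcoef-zero : ∀ {ℓ} L (γ : Fin ℓ → ℤ) → Hcoef L γ 0 ≈ s γ
  Hcoef-zero [] γ = refl
  Hcoef-zero (x ∷ L) γ = trans (Hcoef-zero L (raise x 0 γ)) (s-cong (raise-zero x γ))

  Hcoef-∷-suc : ∀ {ℓ} x L (γ : Fin ℓ → ℤ) n
    → Hcoef (x ∷ L) γ (suc n) ≈ Hcoef L γ (suc n) + Hcoef (x ∷ L) (raise x 1 γ) n
  Hcoef-∷-suc x L γ n = trans (sumTo-suc n (λ m → Hcoef L (raise x m γ) (suc n ∸ m)))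
    (+-cong (Hcoef-cong L (raise-zero x γ) (suc n))
            (sumTo-cong n (λ m _ → Hcoef-cong L (raise-suc x m γ) (n ∸ m))))

  -- Raising operators commute, so H(Ψ; γ) depends only on the set of roots Ψ.
  Hcoef-↭ : ∀ {ℓ} {L L′} → L ↭ L′ → (γ : Fin ℓ → ℤ) → Hcoef L γ ≈ˢ Hcoef L′ γ
  Hcoef-↭ Perm.refl γ n = refl
  Hcoef-↭ (Perm.prep x L↭L′) γ n = sumTo-cong n (λ m _ → Hcoef-↭ L↭L′ (raise x m γ) (n ∸ m))
  Hcoef-↭ {L′ = _ ∷ _ ∷ L′} (Perm.swap x y L↭L′) γ n =
    trans (sumTriangle-cong n (λ a b c → trans (Hcoef-↭ L↭L′ (raise y b (raise x a γ)) c)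
                                                (Hcoef-cong L′ (≡.sym ∘ raise-comm x y a b γ) c)))
          (sym (sumTriangle-swap n (λ a b c → Hcoef L′ (raise x b (raise y a γ)) c)))
  Hcoef-↭ (Perm.trans L↭L′ L′↭L″) γ n = trans (Hcoef-↭ L↭L′ γ n) (Hcoef-↭ L′↭L″ γ n)

  module Alternation {ℓ : ℕ} (r : ℕ) (r+1<ℓ : suc r ℕ.< ℓ) where

    Antisymmetric : List Root → Set _
    Antisymmetric L = ∀ (γ : Fin ℓ → ℤ) n → Hcoef L (dotSwap r γ) n ≈ - Hcoef L γ n

    Vanishing : List Root → Set _
    Vanishing L = ∀ (γ : Fin ℓ → ℤ) → DotSwapFixed r γ → ∀ n → Hcoef L γ n ≈ 0#

    dotSwap-raise² : ∀ x a b (γ : Fin ℓ → ℤ)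
      → dotSwap r (raise (swapRoot (suc r) x) a (raise x b γ)) ≗ raise (swapRoot (suc r) x) b (raise x a (dotSwap r γ))
    dotSwap-raise² x a b γ f =
      ≡.trans (dotSwap-raise r r+1<ℓ (swapRoot (suc r) x) a (raise x b γ) f)
      (≡.trans (raise-cong (swapRoot (suc r) (swapRoot (suc r) x)) a (dotSwap-raise r r+1<ℓ x b γ) f)
      (≡.trans (≡.cong (λ y → raise y a (raise (swapRoot (suc r) x) b (dotSwap r γ)) f) (swapRoot-involutive (suc r) x))
               (raise-comm x (swapRoot (suc r) x) a b (dotSwap r γ) f)))

    Alternating : List Root → Set _
    Alternating L = Antisymmetric L × Vanishing L

    alternating-[] : Alternating []
    alternating-[] = antisymmetric , vanishing
      where
      antisymmetric : Antisymmetric []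
      antisymmetric γ zero = s-dotSwap r r+1<ℓ γ
      antisymmetric γ (suc n) = sym -0#≈0#
      vanishing : Vanishing []
      vanishing γ fixed zero = s-dotSwapFixed r r+1<ℓ γ fixed
      vanishing γ fixed (suc n) = refl

    alternating-↭ : ∀ {L L′} → L ↭ L′ → Alternating L′ → Alternating L
    alternating-↭ L↭L′ (antisymmetric , vanishing) =
      (λ γ n → trans (Hcoef-↭ L↭L′ (dotSwap r γ) n) (trans (antisymmetric γ n) (-‿cong (sym (Hcoef-↭ L↭L′ γ n))))) ,
      (λ γ fixed n → trans (Hcoef-↭ L↭L′ γ n) (vanishing γ fixed n))

    alternating-fixed : ∀ {x L} → swapRoot (suc r) x ≡ x → Alternating L → Alternating (x ∷ L)
    alternating-fixed {x} {L} σx≡x (antisymmetric , vanishing) = antisymmetric′ , vanishing′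
      where
      dotSwap-raise-x : ∀ m γ → dotSwap r (raise x m γ) ≗ raise x m (dotSwap r γ)
      dotSwap-raise-x m γ f = ≡.trans (dotSwap-raise r r+1<ℓ x m γ f) (≡.cong (λ y → raise y m (dotSwap r γ) f) σx≡x)
      antisymmetric′ : Antisymmetric (x ∷ L)
      antisymmetric′ γ n = trans
        (sumTo-cong n (λ m _ → trans (Hcoef-cong L (≡.sym ∘ dotSwap-raise-x m γ) (n ∸ m))
                                     (antisymmetric (raise x m γ) (n ∸ m))))
        (sumTo-neg n (λ m → Hcoef L (raise x m γ) (n ∸ m)))
      vanishing′ : Vanishing (x ∷ L)
      vanishing′ γ fixed n = sumTo-0# n _ (λ m _ →
        vanishing (raise x m γ) (λ f → ≡.trans (dotSwap-raise-x m γ f) (raise-cong x m fixed f)) (n ∸ m))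

    -- The two roots x, σx contribute a triangle sum whose summand is antisymmetric in the two exponents.
    alternating-pair : ∀ x {L} → Alternating L → Alternating (x ∷ swapRoot (suc r) x ∷ L)
    alternating-pair x {L} (antisymmetric , vanishing) = antisymmetric′ , vanishing′
      where
      σx = swapRoot (suc r) x
      G : (Fin ℓ → ℤ) → ℕ → ℕ → ℕ → Carrier
      G γ a b c = Hcoef L (raise σx b (raise x a γ)) c
      G-dotSwap : ∀ γ a b c → G (dotSwap r γ) a b c ≈ - G γ b a c
      G-dotSwap γ a b c =
        trans (Hcoef-cong L (≡.sym ∘ dotSwap-raise² x a b γ) c) (antisymmetric (raise σx a (raise x b γ)) c)
      antisymmetric′ : Antisymmetric (x ∷ σx ∷ L)
      antisymmetric′ γ n = begin
        sumTriangle n (G (dotSwap r γ))              ≈⟨ sumTriangle-cong n (G-dotSwap γ) ⟩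
        sumTriangle n (λ a b c → - G γ b a c)        ≈⟨ sumTriangle-neg n (λ a b c → G γ b a c) ⟩
        - sumTriangle n (λ a b c → G γ b a c)        ≈⟨ -‿cong (sumTriangle-swap n (G γ)) ⟨
        - sumTriangle n (G γ)                        ∎
      vanishing′ : Vanishing (x ∷ σx ∷ L)
      vanishing′ γ fixed n = sumTriangle-alternating n (G γ)
        (λ a b c → trans (Hcoef-cong L (raise-cong σx b (raise-cong x a (≡.sym ∘ fixed))) c) (G-dotSwap γ a b c))
        (λ a c → vanishing (raise σx a (raise x a γ)) (diagonal-fixed a) c)
        where
        diagonal-fixed : ∀ a → DotSwapFixed r (raise σx a (raise x a γ))
        diagonal-fixed a f = ≡.trans (dotSwap-raise² x a a γ f) (raise-cong σx a (raise-cong x a fixed) f)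

    alternating : ∀ n L → length L ℕ.≤ n → Unique L → SwapClosed (suc r) L → Alternating L
    alternating _ [] _ _ _ = alternating-[]
    alternating (suc n) (x ∷ L) (s≤s |L|≤n) u closed with swapRoot (suc r) x ≟ᴿ x
    ... | yes σx≡x =
      alternating-fixed {L = L} σx≡x (alternating n L |L|≤n (Unique-tail u) (SwapClosed-fixed-tail σx≡x u closed))
    ... | no σx≢x with SwapClosed-partner σx≢x u closed
    ... | L′ , L↭ , u′ , closed′ = alternating-↭ (Perm.prep x L↭)
      (alternating-pair x {L′} (alternating n L′ |L′|≤n (Unique-tail (Unique-tail u′)) closed′))
      where
      |L′|≤n : length L′ ℕ.≤ n
      |L′|≤n = ℕP.≤-trans (ℕP.n≤1+n (length L′)) (ℕP.≤-trans (ℕP.≤-reflexive (≡.sym (PermP.↭-length L↭))) |L|≤n)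

    Hcoef-vanishing : ∀ {L} → Unique L → SwapClosed (suc r) L
      → (γ : Fin ℓ → ℤ) → DotSwapFixed r γ → ∀ n → Hcoef L γ n ≈ 0#
    Hcoef-vanishing {L} u closed = proj₂ (alternating (length L) L ℕP.≤-refl u closed)

    Hcoef-remove-root : ∀ {L L′ x} → L ↭ x ∷ L′ → Unique L → SwapClosed (suc r) L
      → (γ : Fin ℓ → ℤ) → DotSwapFixed r (raise x 1 γ) → ∀ n → Hcoef L γ (suc n) ≈ Hcoef L′ γ (suc n)
    Hcoef-remove-root {L} {L′} {x} L↭ u closed γ fixed n = begin
      Hcoef L γ (suc n)                                   ≈⟨ Hcoef-↭ L↭ γ (suc n) ⟩
      Hcoef (x ∷ L′) γ (suc n)                            ≈⟨ Hcoef-∷-suc x L′ γ n ⟩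
      Hcoef L′ γ (suc n) + Hcoef (x ∷ L′) (raise x 1 γ) n ≈⟨ +-congˡ (Hcoef-↭ L↭ (raise x 1 γ) n) ⟨
      Hcoef L′ γ (suc n) + Hcoef L (raise x 1 γ) n        ≈⟨ +-congˡ (Hcoef-vanishing u closed (raise x 1 γ) fixed n) ⟩
      Hcoef L′ γ (suc n) + 0#                             ≈⟨ +-identityʳ _ ⟩
      Hcoef L′ γ (suc n)                                  ∎

≤-via-difference : ∀ {A B x y : ℤ} → B ℤ.- A ≡ y ℤ.- x → x ℤ.≤ y → A ℤ.≤ B
≤-via-difference B-A≡y-x x≤y = ℤP.0≤i-j⇒j≤i (≡.subst (+ 0 ℤ.≤_) (≡.sym B-A≡y-x) (ℤP.i≤j⇒0≤j-i x≤y))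

module _ {ℓ : ℕ} (k : ℕ) where

  -- (i , j) ∈ Δ^k(γ) iff it is a positive root with wall k γ i < j.
  wall : (Fin ℓ → ℤ) → ℕ → ℤ
  wall γ i = (+ k ℤ.- γ ⟨ i ⟩) ℤ.+ + i

  Δk⇒wall< : ∀ {γ i j n} → wall γ i ≡ + n → Δk k γ (i , j) → n ℕ.< j
  Δk⇒wall< wall≡n (_ , wall<j) = ℤP.drop‿+<+ (≡.subst (ℤ._< + _) wall≡n wall<j)

  wall<⇒Δk : ∀ {γ i j n} → wall γ i ≡ + n → Pos ℓ (i , j) → n ℕ.< j → Δk k γ (i , j)
  wall<⇒Δk wall≡n pos n<j = pos , ≡.subst (ℤ._< + _) (≡.sym wall≡n) (+<+ n<j)

  wall-shift : ∀ (γ γ′ : Fin ℓ → ℤ) i d → γ′ ⟨ i ⟩ ≡ γ ⟨ i ⟩ ℤ.+ d → wall γ′ i ≡ wall γ i ℤ.- d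
  wall-shift γ γ′ i d γ′≡γ+d = ≡.trans (≡.cong (λ u → (+ k ℤ.- u) ℤ.+ + i) γ′≡γ+d) (lemma (+ k) (γ ⟨ i ⟩) (+ i) d)
    where
    lemma : ∀ K g I d → (K ℤ.- (g ℤ.+ d)) ℤ.+ I ≡ ((K ℤ.- g) ℤ.+ I) ℤ.- d
    lemma = solve-∀

-- Notation: p = z = suc r, q = z + 1, a = y + 1, α = (a , q), ν = μ + ε_a - ε_q.
module Setting (k ℓ : ℕ) (μ : Fin ℓ → ℤ) (r y : ℕ)
  (μ≤k : ∀ i → μ i ℤ.≤ + k)
  (μ-dominant : ∀ i → 1 ℕ.≤ i → i ℕ.< ℓ → (μ ⟨ suc i ⟩ ℤ.+ + (ℓ ∸ i ∸ 1)) ℤ.≤ (μ ⟨ i ⟩ ℤ.+ + (ℓ ∸ i)))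
  (q≤ℓ : suc r ℕ.< ℓ)
  (α-removable : UpIs ℓ (Δk k μ) (suc (suc r)) (suc y))
  (μp≡μq-1 : μ ⟨ suc r ⟩ ≡ μ ⟨ suc (suc r) ⟩ ℤ.- + 1)
  (μa≤μy : μext k μ (suc y) ℤ.≤ μext k μ y)
  where

  p q a : ℕ
  p = suc r
  q = suc p
  a = suc y

  α : Root
  α = (a , q)

  ν : Fin ℓ → ℤ
  ν = addε (addε μ a (+ 1)) q (ℤ.- + 1)

  p≤ℓ : p ℕ.≤ ℓ
  p≤ℓ = ℕP.≤-trans (ℕP.n≤1+n p) q≤ℓ

  μ⟨⟩≤k : ∀ i → μ ⟨ i ⟩ ℤ.≤ + k
  μ⟨⟩≤k zero = +≤+ z≤n
  μ⟨⟩≤k (suc i) with i ℕ.<? ℓ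
  ... | yes i<ℓ = μ≤k (Fin.fromℕ< i<ℓ)
  ... | no _ = +≤+ z≤n

  w : ℕ → ℕ
  w i = ℤ.∣ wall k μ i ∣

  i≤wall : ∀ i → + i ℤ.≤ wall k μ i
  i≤wall i = ≡.subst (ℤ._≤ wall k μ i) (ℤP.+-identityˡ (+ i)) (ℤP.+-monoˡ-≤ (+ i) (ℤP.i≤j⇒0≤j-i (μ⟨⟩≤k i)))

  wall≡w : ∀ i → wall k μ i ≡ + w i
  wall≡w i = ≡.sym (ℤP.0≤i⇒+∣i∣≡i (ℤP.≤-trans (+≤+ z≤n) (i≤wall i)))

  i≤w : ∀ i → i ℕ.≤ w i
  i≤w i = ℤP.drop‿+≤+ (≡.subst (+ i ℤ.≤_) (wall≡w i) (i≤wall i))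

  Ψ⇒w< : ∀ {i j} → Δk k μ (i , j) → w i ℕ.< j
  Ψ⇒w< {i} = Δk⇒wall< k (wall≡w i)

  w<⇒Ψ : ∀ {i j} → Pos ℓ (i , j) → w i ℕ.< j → Δk k μ (i , j)
  w<⇒Ψ {i} = wall<⇒Δk k (wall≡w i)

  w-suc : ∀ i → 1 ℕ.≤ i → i ℕ.< ℓ → w i ℕ.≤ w (suc i)
  w-suc i 1≤i i<ℓ = ℤP.drop‿+≤+ (≡.subst₂ ℤ._≤_ (wall≡w i) (wall≡w (suc i)) wall-step)
    where
    c = ℓ ∸ i ∸ 1
    ℓ∸i≡1+c : ℓ ∸ i ≡ suc c
    ℓ∸i≡1+c = ≡.sym (ℕP.suc-pred (ℓ ∸ i) {{ℕ.>-nonZero (ℕP.m<n⇒0<n∸m i<ℓ)}})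
    dominant : (μ ⟨ suc i ⟩ ℤ.+ + c) ℤ.≤ (μ ⟨ i ⟩ ℤ.+ (+ 1 ℤ.+ + c))
    dominant = ≡.subst (λ u → (μ ⟨ suc i ⟩ ℤ.+ + c) ℤ.≤ (μ ⟨ i ⟩ ℤ.+ + u)) ℓ∸i≡1+c (μ-dominant i 1≤i i<ℓ)
    lemma : ∀ K m₀ m₁ I C → ((K ℤ.- m₁) ℤ.+ (+ 1 ℤ.+ I)) ℤ.- ((K ℤ.- m₀) ℤ.+ I) ≡ (m₀ ℤ.+ (+ 1 ℤ.+ C)) ℤ.- (m₁ ℤ.+ C)
    lemma = solve-∀
    wall-step : wall k μ i ℤ.≤ wall k μ (suc i)
    wall-step = ≤-via-difference (lemma (+ k) (μ ⟨ i ⟩) (μ ⟨ suc i ⟩) (+ i) (+ c)) dominant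

  w-mono : ∀ {i i′} → 1 ℕ.≤ i → i ℕ.≤ i′ → i′ ℕ.≤ ℓ → w i ℕ.≤ w i′
  w-mono {i} {i′} 1≤i i≤i′ i′≤ℓ with ℕP.m≤n⇒m<n∨m≡n i≤i′
  ... | inj₂ ≡.refl = ℕP.≤-refl
  w-mono {i} {suc i′} 1≤i _ i′<ℓ | inj₁ (s≤s i≤i′) =
    ℕP.≤-trans (w-mono 1≤i i≤i′ (ℕP.<⇒≤ i′<ℓ)) (w-suc i′ (ℕP.≤-trans 1≤i i≤i′) i′<ℓ)

  μext-positive : ∀ {u} → 1 ℕ.≤ u → μext k μ u ≡ μ ⟨ u ⟩
  μext-positive {suc u} _ = ≡.refl

  α∈Ψ : Δk k μ α
  α∈Ψ = proj₁ α-removable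

  a<q : a ℕ.< q
  a<q = proj₁ (proj₂ (proj₁ α∈Ψ))

  a≤p : a ℕ.≤ p
  a≤p = ℕP.≤-pred a<q

  a≤ℓ : a ℕ.≤ ℓ
  a≤ℓ = ℕP.≤-trans (ℕP.<⇒≤ a<q) q≤ℓ

  below-α∉Ψ : ∀ {x} → Pos ℓ x → x ≢ α → x ≤ᴿ α → ¬ Δk k μ x
  below-α∉Ψ {x} pos x≢α x≤α x∈Ψ = proj₂ (proj₂ (proj₂ α-removable) x α (x∈Ψ , x≢α) (proj₁ α∈Ψ) x≤α) ≡.refl

  w[a]≡p : w a ≡ p
  w[a]≡p = ℕP.≤-antisym (ℕP.≤-pred (Ψ⇒w< α∈Ψ)) p≤w[a]
    where
    p≤w[a] : p ℕ.≤ w a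
    p≤w[a] with a ℕ.<? p
    ... | yes a<p = ℕP.≮⇒≥ (λ w[a]<p → below-α∉Ψ pos (λ e → ℕP.<-irrefl (≡.cong proj₂ e) (ℕP.n<1+n p))
                                          (ℕP.≤-refl , ℕP.n≤1+n p) (w<⇒Ψ pos w[a]<p))
      where
      pos : Pos ℓ (a , p)
      pos = s≤s z≤n , a<p , p≤ℓ
    ... | no a≮p = ℕP.≤-trans (ℕP.≮⇒≥ a≮p) (i≤w a)

  q≤w[a+1] : a ℕ.< p → q ℕ.≤ w (suc a)
  q≤w[a+1] a<p = ℕP.≮⇒≥ (λ w<q → below-α∉Ψ pos (λ e → ℕP.<-irrefl (≡.sym (≡.cong proj₁ e)) (ℕP.n<1+n a))
                                              (ℕP.n≤1+n a , ℕP.≤-refl) (w<⇒Ψ pos w<q))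
    where
    pos : Pos ℓ (suc a , q)
    pos = s≤s z≤n , s≤s a<p , q≤ℓ

  q≤w-after-a : a ℕ.< p → ∀ {i} → a ℕ.< i → i ℕ.≤ q → q ℕ.≤ w i
  q≤w-after-a a<p a<i i≤q = ℕP.≤-trans (q≤w[a+1] a<p) (w-mono (s≤s z≤n) a<i (ℕP.≤-trans i≤q q≤ℓ))

  w<p-before-a : ∀ {i} → 1 ℕ.≤ i → i ℕ.< a → w i ℕ.< p
  w<p-before-a {i} 1≤i (s≤s i≤y) =
    ℕP.≤-<-trans (w-mono 1≤i i≤y (ℕP.≤-trans (ℕP.n≤1+n y) a≤ℓ)) (≡.subst (w y ℕ.<_) w[a]≡p w[y]<w[a])
    where
    μa≤μy′ : μ ⟨ a ⟩ ℤ.≤ μ ⟨ y ⟩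
    μa≤μy′ = ≡.subst (μ ⟨ a ⟩ ℤ.≤_) (μext-positive (ℕP.≤-trans 1≤i i≤y)) μa≤μy
    lemma : ∀ K m m′ Y → ((K ℤ.- m) ℤ.+ (+ 1 ℤ.+ Y)) ℤ.- (+ 1 ℤ.+ ((K ℤ.- m′) ℤ.+ Y)) ≡ m′ ℤ.- m
    lemma = solve-∀
    w[y]<w[a] : w y ℕ.< w a
    w[y]<w[a] = ℤP.drop‿+≤+ (≡.subst₂ ℤ._≤_ (≡.cong (ℤ._+_ (+ 1)) (wall≡w y)) (wall≡w a)
                  (≤-via-difference (lemma (+ k) (μ ⟨ a ⟩) (μ ⟨ y ⟩) (+ y)) μa≤μy′))

  w[q]≡w[p] : w q ≡ w p
  w[q]≡w[p] = ℤP.+-injective (≡.trans (≡.sym (wall≡w q)) (≡.trans wall-q≡wall-p (wall≡w p)))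
    where
    lemma : ∀ K x P → (K ℤ.- x) ℤ.+ (+ 1 ℤ.+ P) ≡ (K ℤ.- (x ℤ.- + 1)) ℤ.+ P
    lemma = solve-∀
    wall-q≡wall-p : wall k μ q ≡ wall k μ p
    wall-q≡wall-p = ≡.trans (lemma (+ k) (μ ⟨ q ⟩) (+ p)) (≡.cong (λ u → (+ k ℤ.- u) ℤ.+ + p) (≡.sym μp≡μq-1))

  w[p]<q⇒a≡p : w p ℕ.< q → a ≡ p
  w[p]<q⇒a≡p w[p]<q with a ℕ.<? p
  ... | yes a<p = ⊥-elim (ℕP.<⇒≱ w[p]<q (q≤w-after-a a<p a<p (ℕP.n≤1+n p)))
  ... | no a≮p = ℕP.≤-antisym a≤p (ℕP.≮⇒≥ a≮p)

  a≢q : a ≢ q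
  a≢q = ℕP.<⇒≢ a<q

  ν⟨a⟩ : ν ⟨ a ⟩ ≡ μ ⟨ a ⟩ ℤ.+ + 1
  ν⟨a⟩ = ≡.trans (⟨⟩-addε-≢ (addε μ a (+ 1)) (ℤ.- + 1) a≢q) (⟨⟩-addε-≡ μ (+ 1) (s≤s z≤n) a≤ℓ)

  ν⟨q⟩ : ν ⟨ q ⟩ ≡ μ ⟨ q ⟩ ℤ.+ ℤ.- + 1
  ν⟨q⟩ = ≡.trans (⟨⟩-addε-≡ (addε μ a (+ 1)) (ℤ.- + 1) (s≤s z≤n) q≤ℓ)
                 (≡.cong (ℤ._+ ℤ.- + 1) (⟨⟩-addε-≢ μ (+ 1) (a≢q ∘ ≡.sym)))

  ν⟨i⟩ : ∀ {i} → i ≢ a → i ≢ q → ν ⟨ i ⟩ ≡ μ ⟨ i ⟩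
  ν⟨i⟩ i≢a i≢q = ≡.trans (⟨⟩-addε-≢ (addε μ a (+ 1)) (ℤ.- + 1) i≢q) (⟨⟩-addε-≢ μ (+ 1) i≢a)

  wallν[a]≡r : wall k ν a ≡ + r
  wallν[a]≡r = ≡.trans (wall-shift k μ ν a (+ 1) ν⟨a⟩) (≡.cong (ℤ._- + 1) (≡.trans (wall≡w a) (≡.cong +_ w[a]≡p)))

  wallν[q]≡1+w[q] : wall k ν q ≡ + suc (w q)
  wallν[q]≡1+w[q] = ≡.trans (wall-shift k μ ν q (ℤ.- + 1) ν⟨q⟩)
                            (≡.trans (≡.cong (λ u → u ℤ.- ℤ.- + 1) (wall≡w q)) (lemma (w q)))
    where
    lemma : ∀ n → + n ℤ.- ℤ.- + 1 ≡ + suc n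
    lemma n = ≡.cong +_ (ℕP.+-comm n 1)

  wallν[i]≡w[i] : ∀ {i} → i ≢ a → i ≢ q → wall k ν i ≡ + w i
  wallν[i]≡w[i] {i} i≢a i≢q = ≡.trans (≡.cong (λ u → (+ k ℤ.- u) ℤ.+ + i) (ν⟨i⟩ i≢a i≢q)) (wall≡w i)

  α′ β : Root
  α′ = (a , p)
  β = (q , suc (w q))

  Δkν⇒ : ∀ {i j} → Δk k ν (i , j) → i ≢ a → i ≢ q → w i ℕ.< j
  Δkν⇒ x∈Δkν i≢a i≢q = Δk⇒wall< k (wallν[i]≡w[i] i≢a i≢q) x∈Δkν

  ⇒Δkν : ∀ {i j} → Pos ℓ (i , j) → i ≢ a → i ≢ q → w i ℕ.< j → Δk k ν (i , j)
  ⇒Δkν pos i≢a i≢q = wall<⇒Δk k (wallν[i]≡w[i] i≢a i≢q) pos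

  Δkν∖Ψ : ∀ x → Δk k ν x → ¬ Δk k μ x → x ≡ α′
  Δkν∖Ψ (i , j) x∈Δkν x∉Ψ with i ℕ.≟ a | i ℕ.≟ q
  ... | yes ≡.refl | _ = ≡.cong (a ,_) (ℕP.≤-antisym j≤p (Δk⇒wall< k wallν[a]≡r x∈Δkν))
    where
    j≤p : j ℕ.≤ p
    j≤p = ≡.subst (j ℕ.≤_) w[a]≡p (ℕP.≮⇒≥ (x∉Ψ ∘ w<⇒Ψ (proj₁ x∈Δkν)))
  ... | no _ | yes ≡.refl =
        ⊥-elim (x∉Ψ (w<⇒Ψ (proj₁ x∈Δkν) (ℕP.<-trans (ℕP.n<1+n (w q)) (Δk⇒wall< k wallν[q]≡1+w[q] x∈Δkν))))
  ... | no i≢a | no i≢q = ⊥-elim (x∉Ψ (w<⇒Ψ (proj₁ x∈Δkν) (Δkν⇒ x∈Δkν i≢a i≢q)))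

  Ψ∖Δkν : ∀ x → Δk k μ x → ¬ Δk k ν x → x ≡ β
  Ψ∖Δkν (i , j) x∈Ψ x∉Δkν with i ℕ.≟ a | i ℕ.≟ q
  ... | yes ≡.refl | _ = ⊥-elim (x∉Δkν (wall<⇒Δk k wallν[a]≡r (proj₁ x∈Ψ)
                            (ℕP.<-trans (ℕP.n<1+n r) (≡.subst (ℕ._< j) w[a]≡p (Ψ⇒w< x∈Ψ)))))
  ... | no _ | yes ≡.refl = ≡.cong (q ,_)
        (ℕP.≤-antisym (ℕP.≮⇒≥ (x∉Δkν ∘ wall<⇒Δk k wallν[q]≡1+w[q] (proj₁ x∈Ψ))) (Ψ⇒w< x∈Ψ))
  ... | no i≢a | no i≢q = ⊥-elim (x∉Δkν (⇒Δkν (proj₁ x∈Ψ) i≢a i≢q (Ψ⇒w< x∈Ψ)))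

  α′∈Δkν : a ℕ.< p → Δk k ν α′
  α′∈Δkν a<p = wall<⇒Δk k wallν[a]≡r (s≤s z≤n , a<p , p≤ℓ) (ℕP.n<1+n r)

  α′∉Ψ : ¬ Δk k μ α′
  α′∉Ψ α′∈Ψ = ℕP.<-irrefl w[a]≡p (Ψ⇒w< α′∈Ψ)

  β∉Δkν : ¬ Δk k ν β
  β∉Δkν β∈Δkν = ℕP.<-irrefl ≡.refl (Δk⇒wall< k wallν[q]≡1+w[q] β∈Δkν)

  a≡p⇒Ψ⊆Δkν : a ≡ p → ∀ {x} → Δk k μ x → Δk k ν x
  a≡p⇒Ψ⊆Δkν a≡p {i , j} x∈Ψ with i ℕ.≟ a | i ℕ.≟ q
  ... | yes ≡.refl | _ = wall<⇒Δk k wallν[a]≡r pos (ℕP.<-trans (ℕP.n<1+n r) (≡.subst (ℕ._< j) a≡p (proj₁ (proj₂ pos))))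
    where pos = proj₁ x∈Ψ
  ... | no _ | yes ≡.refl = wall<⇒Δk k wallν[q]≡1+w[q] pos
        (≡.subst (λ u → suc u ℕ.< j) (≡.sym (≡.trans w[q]≡w[p] (≡.trans (≡.cong w (≡.sym a≡p)) w[a]≡p)))
                 (proj₁ (proj₂ pos)))
    where pos = proj₁ x∈Ψ
  ... | no i≢a | no i≢q = ⇒Δkν (proj₁ x∈Ψ) i≢a i≢q (Ψ⇒w< x∈Ψ)

  a≡p⇒Δkν⊆Ψ : a ≡ p → ∀ {x} → Δk k ν x → Δk k μ x
  a≡p⇒Δkν⊆Ψ a≡p {i , j} x∈Δkν with i ℕ.≟ a | i ℕ.≟ q
  ... | yes ≡.refl | _ = w<⇒Ψ pos (≡.subst (ℕ._< j) (≡.trans a≡p (≡.sym w[a]≡p)) (proj₁ (proj₂ pos)))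
    where pos = proj₁ x∈Δkν
  ... | no _ | yes ≡.refl = w<⇒Ψ (proj₁ x∈Δkν) (ℕP.<-trans (ℕP.n<1+n (w q)) (Δk⇒wall< k wallν[q]≡1+w[q] x∈Δkν))
  ... | no i≢a | no i≢q = w<⇒Ψ (proj₁ x∈Δkν) (Δkν⇒ x∈Δkν i≢a i≢q)

  data Position : ℕ → Set where
    at-p : Position p
    at-q : Position q
    away : ∀ {x} → x ≢ p → x ≢ q → Position x

  position : ∀ x → Position x
  position x with x ℕ.≟ p | x ℕ.≟ q
  ... | yes ≡.refl | _ = at-p
  ... | no _ | yes ≡.refl = at-q
  ... | no x≢p | no x≢q = away x≢p x≢q

  σ : Root → Root
  σ = swapRoot p

  σ-at : ∀ i j {i′ j′} → swapAdj p i ≡ i′ → swapAdj p j ≡ j′ → σ (i , j) ≡ (i′ , j′)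
  σ-at _ _ = ≡.cong₂ _,_

  swap-Ψ : ∀ x → Δk k μ x → x ≢ α → Δk k μ (σ x)
  swap-Ψ (i , j) x∈Ψ@((1≤i , i<j , j≤ℓ) , _) x≢α with position i | position j
  ... | at-p | at-p = ⊥-elim (ℕP.<-irrefl ≡.refl i<j)
  ... | at-p | at-q = ⊥-elim (x≢α (≡.cong (_, q) (≡.sym (w[p]<q⇒a≡p (Ψ⇒w< x∈Ψ)))))
  ... | at-p | away j≢p j≢q = ≡.subst (Δk k μ) (≡.sym (σ-at p j (swapAdj-self p) (swapAdj-other p j j≢p j≢q)))
        (w<⇒Ψ (s≤s z≤n , ℕP.≤∧≢⇒< i<j (j≢q ∘ ≡.sym) , j≤ℓ) (≡.subst (ℕ._< j) (≡.sym w[q]≡w[p]) (Ψ⇒w< x∈Ψ)))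
  ... | at-q | at-p = ⊥-elim (ℕP.<-asym (ℕP.n<1+n p) i<j)
  ... | at-q | at-q = ⊥-elim (ℕP.<-irrefl ≡.refl i<j)
  ... | at-q | away j≢p j≢q = ≡.subst (Δk k μ) (≡.sym (σ-at q j (swapAdj-suc p) (swapAdj-other p j j≢p j≢q)))
        (w<⇒Ψ (s≤s z≤n , ℕP.<-trans (ℕP.n<1+n p) i<j , j≤ℓ) (≡.subst (ℕ._< j) w[q]≡w[p] (Ψ⇒w< x∈Ψ)))
  ... | away i≢p i≢q | at-p = ≡.subst (Δk k μ) (≡.sym (σ-at i p (swapAdj-other p i i≢p i≢q) (swapAdj-self p)))
        (w<⇒Ψ (1≤i , ℕP.<-trans i<j (ℕP.n<1+n p) , q≤ℓ) (ℕP.<-trans (Ψ⇒w< x∈Ψ) (ℕP.n<1+n p)))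
  ... | away i≢p i≢q | at-q = ≡.subst (Δk k μ) (≡.sym (σ-at i q (swapAdj-other p i i≢p i≢q) (swapAdj-suc p)))
        (w<⇒Ψ (1≤i , i<p , p≤ℓ) w[i]<p)
    where
    i<p : i ℕ.< p
    i<p = ℕP.≤∧≢⇒< (ℕP.≤-pred i<j) i≢p
    w[i]<p : w i ℕ.< p
    w[i]<p with ℕP.<-cmp i a
    ... | tri< i<a _ _ = w<p-before-a 1≤i i<a
    ... | tri≈ _ i≡a _ = ⊥-elim (x≢α (≡.cong (_, q) i≡a))
    ... | tri> _ _ a<i = ⊥-elim (ℕP.<⇒≱ (Ψ⇒w< x∈Ψ) (q≤w-after-a (ℕP.<-trans a<i i<p) a<i (ℕP.<⇒≤ i<j)))
  ... | away i≢p i≢q | away j≢p j≢q =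
        ≡.subst (Δk k μ) (≡.sym (σ-at i j (swapAdj-other p i i≢p i≢q) (swapAdj-other p j j≢p j≢q))) x∈Ψ

  σα≡α′ : a ℕ.< p → σ α ≡ α′
  σα≡α′ a<p = σ-at a q (swapAdj-other p a (ℕP.<⇒≢ a<p) a≢q) (swapAdj-suc p)

  σα′≡α : a ℕ.< p → σ α′ ≡ α
  σα′≡α a<p = σ-at a p (swapAdj-other p a (ℕP.<⇒≢ a<p) a≢q) (swapAdj-self p)

  σα∉Ψ : ¬ Δk k μ (σ α)
  σα∉Ψ σα∈Ψ with a ℕ.<? p
  ... | yes a<p = α′∉Ψ (≡.subst (Δk k μ) (σα≡α′ a<p) σα∈Ψ)
  ... | no a≮p with ℕP.≤-antisym a≤p (ℕP.≮⇒≥ a≮p)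
  ...   | ≡.refl = ℕP.<-asym (ℕP.n<1+n p) (≡.subst (λ u → u ℕ.< p) (swapAdj-self p) (proj₁ (proj₂ (proj₁ σα∈Ψ′))))
    where
    σα∈Ψ′ : Δk k μ (swapAdj p p , p)
    σα∈Ψ′ = ≡.subst (λ u → Δk k μ (swapAdj p p , u)) (swapAdj-suc p) σα∈Ψ

  Ψ∖α-swap : ∀ x → Δk k μ x × x ≢ α → Δk k μ (σ x) × σ x ≢ α
  Ψ∖α-swap x (x∈Ψ , x≢α) = swap-Ψ x x∈Ψ x≢α , σx≢α
    where
    σx≢α : σ x ≢ α
    σx≢α σx≡α = σα∉Ψ (≡.subst (Δk k μ) (≡.trans (≡.sym (swapRoot-involutive p x)) (≡.cong σ σx≡α)) x∈Ψ)

  Ψ∪α′-swap : a ℕ.< p → ∀ x → Δk k μ x ⊎ x ≡ α′ → Δk k μ (σ x) ⊎ σ x ≡ α′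
  Ψ∪α′-swap a<p x (inj₂ ≡.refl) = inj₁ (≡.subst (Δk k μ) (≡.sym (σα′≡α a<p)) α∈Ψ)
  Ψ∪α′-swap a<p x (inj₁ x∈Ψ) with x ≟ᴿ α
  ... | yes ≡.refl = inj₂ (σα≡α′ a<p)
  ... | no x≢α = inj₁ (swap-Ψ x x∈Ψ x≢α)

  dotSwapFixed-if-shifted : ∀ (γ : Fin ℓ → ℤ) d → γ ⟨ q ⟩ ≡ μ ⟨ q ⟩ ℤ.+ d → γ ⟨ p ⟩ ≡ μ ⟨ p ⟩ ℤ.+ d → DotSwapFixed r γ
  dotSwapFixed-if-shifted γ d γq≡ γp≡ = dotSwap-fixed r q≤ℓ γ (begin
    γ ⟨ q ⟩                               ≡⟨ γq≡ ⟩
    μ ⟨ q ⟩ ℤ.+ d                         ≡⟨ lemma (μ ⟨ q ⟩) d ⟩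
    ((μ ⟨ q ⟩ ℤ.- + 1) ℤ.+ d) ℤ.+ + 1     ≡⟨ ≡.cong (λ u → (u ℤ.+ d) ℤ.+ + 1) μp≡μq-1 ⟨
    (μ ⟨ p ⟩ ℤ.+ d) ℤ.+ + 1               ≡⟨ ≡.cong (ℤ._+ + 1) γp≡ ⟨
    γ ⟨ p ⟩ ℤ.+ + 1                       ∎)
    where
    open ≡.≡-Reasoning
    lemma : ∀ m d → m ℤ.+ d ≡ ((m ℤ.- + 1) ℤ.+ d) ℤ.+ + 1
    lemma = solve-∀

  a<p⇒p≢a : a ℕ.< p → p ≢ a
  a<p⇒p≢a a<p = ℕP.<⇒≢ a<p ∘ ≡.sym

  p≢q : p ≢ q
  p≢q = ℕP.<⇒≢ (ℕP.n<1+n p)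

  μ-fixed : DotSwapFixed r μ
  μ-fixed = dotSwapFixed-if-shifted μ (+ 0) (≡.sym (ℤP.+-identityʳ _)) (≡.sym (ℤP.+-identityʳ _))

  raise-α′-fixed : a ℕ.< p → DotSwapFixed r (raise α′ 1 ν)
  raise-α′-fixed a<p = dotSwapFixed-if-shifted (raise α′ 1 ν) (ℤ.- + 1)
    (≡.trans (⟨⟩-addε-≢ (addε ν a (+ 1)) (ℤ.- + 1) (p≢q ∘ ≡.sym))
             (≡.trans (⟨⟩-addε-≢ ν (+ 1) (a≢q ∘ ≡.sym)) ν⟨q⟩))
    (≡.trans (⟨⟩-addε-≡ (addε ν a (+ 1)) (ℤ.- + 1) (s≤s z≤n) p≤ℓ)
             (≡.cong (ℤ._+ ℤ.- + 1) (≡.trans (⟨⟩-addε-≢ ν (+ 1) (a<p⇒p≢a a<p)) (ν⟨i⟩ (a<p⇒p≢a a<p) p≢q))))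

  raise-β-fixed : a ℕ.< p → DotSwapFixed r (raise β 1 ν)
  raise-β-fixed a<p = dotSwapFixed-if-shifted (raise β 1 ν) (+ 0)
    (≡.trans (⟨⟩-addε-≢ (addε ν q (+ 1)) (ℤ.- + 1) (ℕP.<⇒≢ q<b))
             (≡.trans (⟨⟩-addε-≡ ν (+ 1) (s≤s z≤n) q≤ℓ) (≡.trans (≡.cong (ℤ._+ + 1) ν⟨q⟩) (lemma (μ ⟨ q ⟩)))))
    (≡.trans (⟨⟩-addε-≢ (addε ν q (+ 1)) (ℤ.- + 1) (ℕP.<⇒≢ (ℕP.<-trans (ℕP.n<1+n p) q<b)))
             (≡.trans (⟨⟩-addε-≢ ν (+ 1) p≢q) (≡.trans (ν⟨i⟩ (a<p⇒p≢a a<p) p≢q) (≡.sym (ℤP.+-identityʳ _)))))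
    where
    q<b : q ℕ.< suc (w q)
    q<b = s≤s (i≤w q)
    lemma : ∀ m → (m ℤ.+ ℤ.- + 1) ℤ.+ + 1 ≡ m ℤ.+ + 0
    lemma = solve-∀

  filter-allPairs-closed : ∀ {P : Pred Root 0ℓ} (P? : Decidable P) → (∀ {x} → P x → Pos ℓ x) → (∀ x → P x → P (σ x))
    → SwapClosed p (filter P? (allPairs ℓ))
  filter-allPairs-closed P? pos closed {x} x∈ = ∈-filter⁺ P? (Pos⇒∈allPairs ℓ (pos Pσx)) Pσx
    where Pσx = closed x (proj₂ (∈-filter⁻ P? {xs = allPairs ℓ} x∈))

  filter-allPairs-unique : ∀ {P : Pred Root 0ℓ} (P? : Decidable P) → Unique (filter P? (allPairs ℓ))
  filter-allPairs-unique P? = UniqueP.filter⁺ P? (allPairs-unique ℓ)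

  Ψ∖α : Pred Root 0ℓ
  Ψ∖α x = Δk k μ x × x ≢ α

  Ψ∖α? : Decidable Ψ∖α
  Ψ∖α? x = Δk? k μ x ×-dec ¬? (x ≟ᴿ α)

  Ψ∪Δkν : Pred Root 0ℓ
  Ψ∪Δkν x = Δk k μ x ⊎ Δk k ν x

  Ψ∪Δkν? : Decidable Ψ∪Δkν
  Ψ∪Δkν? x = Δk? k μ x ⊎-dec Δk? k ν x

  Ψ∖α-list Ψ∪Δkν-list : List Root
  Ψ∖α-list = filter Ψ∖α? (allPairs ℓ)
  Ψ∪Δkν-list = filter Ψ∪Δkν? (allPairs ℓ)

  Ψ∖α-unique : Unique Ψ∖α-list
  Ψ∖α-unique = filter-allPairs-unique Ψ∖α?

  Ψ∖α-closed : SwapClosed p Ψ∖α-list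
  Ψ∖α-closed = filter-allPairs-closed Ψ∖α? (proj₁ ∘ proj₁) Ψ∖α-swap

  Ψ∪Δkν-unique : Unique Ψ∪Δkν-list
  Ψ∪Δkν-unique = filter-allPairs-unique Ψ∪Δkν?

  Ψ↭α∷Ψ∖α : Δk-list k μ ↭ α ∷ Ψ∖α-list
  Ψ↭α∷Ψ∖α = filter-insert-↭ (Δk? k μ) Ψ∖α? (allPairs ℓ) (allPairs-unique ℓ) (Pos⇒∈allPairs ℓ (proj₁ α∈Ψ))
    α∈Ψ (λ α∈Ψ∖α → proj₂ α∈Ψ∖α ≡.refl) _,_ proj₁

  Ψ∪Δkν-pos : ∀ {x} → Ψ∪Δkν x → Pos ℓ x
  Ψ∪Δkν-pos (inj₁ x∈Ψ) = proj₁ x∈Ψ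
  Ψ∪Δkν-pos (inj₂ x∈Δkν) = proj₁ x∈Δkν

  Ψ∪Δkν↭α′∷Ψ : a ℕ.< p → Ψ∪Δkν-list ↭ α′ ∷ Δk-list k μ
  Ψ∪Δkν↭α′∷Ψ a<p = filter-insert-↭ Ψ∪Δkν? (Δk? k μ) (allPairs ℓ) (allPairs-unique ℓ)
    (Pos⇒∈allPairs ℓ (proj₁ (α′∈Δkν a<p))) (inj₂ (α′∈Δkν a<p)) α′∉Ψ in-Ψ inj₁
    where
    in-Ψ : ∀ {x} → Ψ∪Δkν x → x ≢ α′ → Δk k μ x
    in-Ψ (inj₁ x∈Ψ) _ = x∈Ψ
    in-Ψ {x} (inj₂ x∈Δkν) x≢α′ with Δk? k μ x
    ... | yes x∈Ψ = x∈Ψ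
    ... | no x∉Ψ = ⊥-elim (x≢α′ (Δkν∖Ψ x x∈Δkν x∉Ψ))

  Ψ∪Δkν-closed : a ℕ.< p → SwapClosed p Ψ∪Δkν-list
  Ψ∪Δkν-closed a<p = filter-allPairs-closed Ψ∪Δkν? Ψ∪Δkν-pos (λ x x∈ → from (Ψ∪α′-swap a<p x (to x x∈)))
    where
    to : ∀ x → Ψ∪Δkν x → Δk k μ x ⊎ x ≡ α′
    to x (inj₁ x∈Ψ) = inj₁ x∈Ψ
    to x (inj₂ x∈Δkν) with Δk? k μ x
    ... | yes x∈Ψ = inj₁ x∈Ψ
    ... | no x∉Ψ = inj₂ (Δkν∖Ψ x x∈Δkν x∉Ψ)
    from : ∀ {x} → Δk k μ x ⊎ x ≡ α′ → Ψ∪Δkν x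
    from (inj₁ x∈Ψ) = inj₁ x∈Ψ
    from (inj₂ ≡.refl) = inj₂ (α′∈Δkν a<p)

  Ψ∪Δkν↭β∷Δkν : Δk k μ β → Ψ∪Δkν-list ↭ β ∷ Δk-list k ν
  Ψ∪Δkν↭β∷Δkν β∈Ψ = filter-insert-↭ Ψ∪Δkν? (Δk? k ν) (allPairs ℓ) (allPairs-unique ℓ)
    (Pos⇒∈allPairs ℓ (proj₁ β∈Ψ)) (inj₁ β∈Ψ) β∉Δkν in-Δkν inj₂
    where
    in-Δkν : ∀ {x} → Ψ∪Δkν x → x ≢ β → Δk k ν x
    in-Δkν (inj₂ x∈Δkν) _ = x∈Δkν
    in-Δkν {x} (inj₁ x∈Ψ) x≢β with Δk? k ν x
    ... | yes x∈Δkν = x∈Δkν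
    ... | no x∉Δkν = ⊥-elim (x≢β (Ψ∖Δkν x x∈Ψ x∉Δkν))

  Ψ∪Δkν≡Δkν : ¬ Δk k μ β → Ψ∪Δkν-list ≡ Δk-list k ν
  Ψ∪Δkν≡Δkν β∉Ψ = ListP.filter-≐ Ψ∪Δkν? (Δk? k ν) (in-Δkν , inj₂) (allPairs ℓ)
    where
    in-Δkν : ∀ {x} → Ψ∪Δkν x → Δk k ν x
    in-Δkν (inj₂ x∈Δkν) = x∈Δkν
    in-Δkν {x} (inj₁ x∈Ψ) with Δk? k ν x
    ... | yes x∈Δkν = x∈Δkν
    ... | no x∉Δkν = ⊥-elim (β∉Ψ (≡.subst (Δk k μ) (Ψ∖Δkν x x∈Ψ x∉Δkν) x∈Ψ))

  Ψ≡Δkν : a ≡ p → Δk-list k μ ≡ Δk-list k ν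
  Ψ≡Δkν a≡p = ListP.filter-≐ (Δk? k μ) (Δk? k ν) (a≡p⇒Ψ⊆Δkν a≡p , a≡p⇒Δkν⊆Ψ a≡p) (allPairs ℓ)

  module _ {c ℓ′ : Level} (R : CommutativeRing c ℓ′) (h : ℕ → CommutativeRing.Carrier R) where
    open CommutativeRing R hiding (zero)
    open Sym R h
    open Symmetric R h
    open Alternation r q≤ℓ
    open import Relation.Binary.Reasoning.Setoid setoid

    kS[μ]≈0 : kS k μ 0 ≈ 0#
    kS[μ]≈0 = trans (Hcoef-zero (Δk-list k μ) μ) (s-dotSwapFixed r q≤ℓ μ μ-fixed)

    kS[μ]-suc : ∀ n → kS k μ (suc n) ≈ Hcoef (Δk-list k μ) ν n
    kS[μ]-suc n = begin
      Hcoef (Δk-list k μ) μ (suc n)                             ≈⟨ Hcoef-↭ Ψ↭α∷Ψ∖α μ (suc n) ⟩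
      Hcoef (α ∷ Ψ∖α-list) μ (suc n)                            ≈⟨ Hcoef-∷-suc α Ψ∖α-list μ n ⟩
      Hcoef Ψ∖α-list μ (suc n) + Hcoef (α ∷ Ψ∖α-list) ν n       ≈⟨ +-congʳ (Hcoef-vanishing Ψ∖α-unique Ψ∖α-closed μ μ-fixed (suc n)) ⟩
      0# + Hcoef (α ∷ Ψ∖α-list) ν n                             ≈⟨ +-identityˡ _ ⟩
      Hcoef (α ∷ Ψ∖α-list) ν n                                  ≈⟨ Hcoef-↭ Ψ↭α∷Ψ∖α ν n ⟨
      Hcoef (Δk-list k μ) ν n                                   ∎

    Hcoef-Ψ∪Δkν≈Ψ : a ℕ.< p → ∀ n → Hcoef Ψ∪Δkν-list ν (suc n) ≈ Hcoef (Δk-list k μ) ν (suc n)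
    Hcoef-Ψ∪Δkν≈Ψ a<p =
      Hcoef-remove-root (Ψ∪Δkν↭α′∷Ψ a<p) Ψ∪Δkν-unique (Ψ∪Δkν-closed a<p) ν (raise-α′-fixed a<p)

    Hcoef-Ψ∪Δkν≈Δkν : a ℕ.< p → ∀ n → Hcoef Ψ∪Δkν-list ν (suc n) ≈ kS k ν (suc n)
    Hcoef-Ψ∪Δkν≈Δkν a<p n with Δk? k μ β
    ... | yes β∈Ψ = Hcoef-remove-root (Ψ∪Δkν↭β∷Δkν β∈Ψ) Ψ∪Δkν-unique (Ψ∪Δkν-closed a<p)
                                      ν (raise-β-fixed a<p) n
    ... | no β∉Ψ = reflexive (≡.cong (λ L → Hcoef L ν (suc n)) (Ψ∪Δkν≡Δkν β∉Ψ))

    Hcoef[Ψ]ν≈kS[ν] : ∀ n → Hcoef (Δk-list k μ) ν n ≈ kS k ν n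
    Hcoef[Ψ]ν≈kS[ν] zero = trans (Hcoef-zero (Δk-list k μ) ν) (sym (Hcoef-zero (Δk-list k ν) ν))
    Hcoef[Ψ]ν≈kS[ν] (suc n) with a ℕ.<? p
    ... | yes a<p = trans (sym (Hcoef-Ψ∪Δkν≈Ψ a<p n)) (Hcoef-Ψ∪Δkν≈Δkν a<p n)
    ... | no a≮p = reflexive (≡.cong (λ L → Hcoef L ν (suc n)) (Ψ≡Δkν (ℕP.≤-antisym a≤p (ℕP.≮⇒≥ a≮p))))

lemma7p4 : ∀ {a b : Level} (k ℓ : ℕ) (μ : Fin ℓ → ℤ) (z y : ℕ)
    → 1 ℕ.≤ k → 1 ℕ.≤ ℓ
    → (∀ i → μ i ℤ.≤ + k)
    → (∀ i → 1 ℕ.≤ i → i ℕ.< ℓ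
         → (μ ⟨ suc i ⟩ ℤ.+ + (ℓ ∸ i ∸ 1)) ℤ.≤ (μ ⟨ i ⟩ ℤ.+ + (ℓ ∸ i)))
    → 1 ℕ.≤ z → z ℕ.≤ ℓ ∸ 1
    → UpIs ℓ (Δk k μ) (suc z) (suc y)
    → μ ⟨ z ⟩ ≡ μ ⟨ suc z ⟩ ℤ.- + 1
    → μext k μ (suc (suc z)) ℤ.≤ μext k μ (suc z)
    → μext k μ (suc y) ℤ.≤ μext k μ y
    → (R : CommutativeRing a b) (h : ℕ → CommutativeRing.Carrier R)
    → Sym._≈ˢ_ R h (Sym.kS R h k μ)
        (Sym.t·_ R h (Sym.kS R h k (addε (addε μ (suc y) (+ 1)) (suc z) (ℤ.- + 1))))
lemma7p4 k ℓ μ (suc r) y _ 1≤ℓ μ≤k μ-dominant _ z≤ℓ-1 α-removable μz≡μz+1-1 _ μy+1≤μy R h = kS[μ]≈t·kS[ν]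
  where
  open Setting k ℓ μ r y μ≤k μ-dominant (ℕP.m≤pred[n]⇒suc[m]≤n {{ℕ.>-nonZero 1≤ℓ}} z≤ℓ-1)
               α-removable μz≡μz+1-1 μy+1≤μy
  open CommutativeRing R using (trans)
  kS[μ]≈t·kS[ν] : Sym._≈ˢ_ R h (Sym.kS R h k μ) (Sym.t·_ R h (Sym.kS R h k ν))
  kS[μ]≈t·kS[ν] zero = kS[μ]≈0 R h
  kS[μ]≈t·kS[ν] (suc n) = trans (kS[μ]-suc R h n) (Hcoef[Ψ]ν≈kS[ν] R h n)
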